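{- Let $d\ge3$, $m=3(d-1)$, and let $N$ be the cup nilsemigroup described in the context, with atoms $A=\{1,d,d+1,\dots,m-d,m-1\}$ (so $|A|=d$). Then there is an invertible linear transformation of $\mathbb R^d$ sending $F_N$ onto the cone over a $(d-1)$-dimensional cube.
   Context: The cup nilsemigroup for $d\ge3$, $m=3(d-1)$, is $N=\mathbb Z_m\cup\{\infty\}$ (elements of $\mathbb Z_m$ represented by $0,\dots,m-1$) with commutative operation in which $\infty$ is nil and, for $a,b\in\mathbb Z_m$: $a\oplus b=a+b$ if $a=0$ or $b=0$, or if $a,b\in\{1,\dots,d-1\}$ with $a+b\le d-1$, or if $a,b\in\{m-d+1,\dots,m-1\}$ with $(m-a)+(m-b)\le d-1$; otherwise $a\oplus b=\infty$. Thus its non-nil elements ordered by divisibility have cover relations $1\lessdot 2\lessdot\cdots\lessdot d-1$ and $m-1\lessdot m-2\lessdot\cdots\lessdot m-(d-1)$ above the atoms, and its atoms are $p_1,\dots,p_d$ = $1,d,d+1,\dots,m-d,m-1$ in this order. For $z\in\mathbb Z^d_{\ge0}$ let $\bar z=\sum z_ip_i\in\mathbb Z_m$ and $\mathsf Z_N(n)=\{z: z_1p_1\oplus\cdots\oplus z_dp_d=n\}$. Outer Betti element: with $\mathrm{supp}(z)=\{i:z_i>0\}$, $\mathrm{supp}(B)=\bigcup_{z\in B}\mathrm{supp}(z)$, $B-e_i=\{z-e_i:z\in B,z_i>0\}$, a subset $B\subseteq\mathsf Z_N(\infty)$ such that (i) for each $i\in\mathrm{supp}(B)$, $B-e_i=\mathsf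 Z_N(q)$ for some non-nil $q$, and (ii) the graph on $B$ joining elements with intersecting supports is connected. $H_N\subseteq\mathbb R^d$: points with $c\cdot x=c'\cdot x$ for all $c,c'$ in a common $\mathsf Z_N(q)$, $q$ non-nil. Betti inequality: $z\cdot x\ge a\cdot x$ with $z$ in an outer Betti element and $a\in\mathsf Z_N(\bar z)$. $F_N$ is the set of points of $H_N$ satisfying all Betti inequalities. The cone over a $(d-1)$-cube is, e.g., $\{(u,t)\in\mathbb R^{d-1}\times\mathbb R: 0\le u_i\le t \text{ for all } i\}$.
   Formalization: $F_N$ and the cone over the cube are taken as their points in ℚ^d rather than $\mathbb R^d$, and the invertible linear transformation has rational entries. -}

module Defs where

open import Data.Nat as ℕ using (ℕ; zero; suc; _∸_; _<ᵇ_; _≤ᵇ_; _≡ᵇ_)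
open import Data.Bool using (Bool; true; false; if_then_else_; _∧_; _∨_)
open import Data.Maybe using (Maybe; just; nothing)
open import Data.Fin using (Fin; toℕ) renaming (zero to fzero; suc to fsuc)
open import Data.Vec using (Vec; []; _∷_; lookup; updateAt; map; tabulate)
open import Data.List using (List)
open import Data.List.Membership.Propositional using (_∈_)
open import Data.Integer using (+_)
open import Data.Rational using (ℚ; 0ℚ; _/_; _+_; _*_; _≤_)
open import Data.Product using (Σ; ∃; _×_)
open import Relation.Binary.PropositionalEquality using (_≡_; _≢_)
open import Relation.Binary.Construct.Closure.ReflexiveTransitive using (Star)

-- The cup nilsemigroup N = Z_m ∪ {∞}, m = 3(d-1).
-- Elements: `just a` with 0 ≤ a < m (residue class a), `nothing` = ∞.

m : ℕ → ℕ
m d = 3 ℕ.* (d ∸ 1)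

Elt : Set
Elt = Maybe ℕ

reduce : ℕ → ℕ → ℕ
reduce d s = if s <ᵇ m d then s else s ∸ m d

low : ℕ → ℕ → Bool
low d a = (1 ≤ᵇ a) ∧ (a ≤ᵇ d ∸ 1)

high : ℕ → ℕ → Bool
high d a = ((m d ∸ d) ℕ.+ 1 ≤ᵇ a) ∧ (a ≤ᵇ m d ∸ 1)

defined : ℕ → ℕ → ℕ → Bool
defined d a b =
  (a ≡ᵇ 0) ∨ (b ≡ᵇ 0)
  ∨ (low d a ∧ low d b ∧ (a ℕ.+ b ≤ᵇ d ∸ 1))
  ∨ (high d a ∧ high d b ∧ ((m d ∸ a) ℕ.+ (m d ∸ b) ≤ᵇ d ∸ 1))

_⊕⟨_⟩_ : Elt → ℕ → Elt → Elt
nothing ⊕⟨ d ⟩ _ = nothing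
just a ⊕⟨ d ⟩ nothing = nothing
just a ⊕⟨ d ⟩ just b = if defined d a b then just (reduce d (a ℕ.+ b)) else nothing

times : ℕ → ℕ → Elt → Elt
times d zero a = just 0
times d (suc k) a = a ⊕⟨ d ⟩ times d k a

-- the atoms p_1,...,p_d = 1, d, d+1, ..., m-d, m-1  (indexed by Fin d)
atom : (d : ℕ) → Fin d → ℕ
atom d i with toℕ i
... | zero = 1
... | suc j = if suc j ≡ᵇ d ∸ 1 then m d ∸ 1 else d ℕ.+ j

Fact : ℕ → Set
Fact d = Vec ℕ d

evalFold : (d n : ℕ) → (Fin n → ℕ) → Vec ℕ n → Elt
evalFold d .0 p [] = just 0
evalFold d (suc n) p (x ∷ xs) =
  times d x (just (p fzero)) ⊕⟨ d ⟩ evalFold d n (λ i → p (fsuc i)) xs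

eval : (d : ℕ) → Fact d → Elt
eval d z = evalFold d d (atom d) z

dotℕ : {n : ℕ} → Vec ℕ n → Vec ℕ n → ℕ
dotℕ [] [] = 0
dotℕ (a ∷ as) (b ∷ bs) = a ℕ.* b ℕ.+ dotℕ as bs

zbar : (d : ℕ) → Fact d → ℕ
zbar d z = ℕ._%_ (dotℕ z (tabulate (atom d))) (suc (m d ∸ 1))

toℚ : ℕ → ℚ
toℚ n = + n / 1

dot : {n : ℕ} → Vec ℕ n → Vec ℚ n → ℚ
dot [] [] = 0ℚ
dot (c ∷ cs) (x ∷ xs) = toℚ c * x + dot cs xs

InSupp : {d : ℕ} → List (Fact d) → Fin d → Set
InSupp B i = ∃ λ z → z ∈ B × 0 ℕ.< lookup z i

-- w ∈ B - e_i  (i.e. w + e_i ∈ B; then automatically (w+e_i)_i > 0)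
_∈_-e_ : {d : ℕ} → Fact d → List (Fact d) → Fin d → Set
w ∈ B -e i = updateAt w i suc ∈ B

Meet : {d : ℕ} → Fact d → Fact d → Set
Meet z z' = ∃ λ i → 0 ℕ.< lookup z i × 0 ℕ.< lookup z' i

Adj : {d : ℕ} → List (Fact d) → Fact d → Fact d → Set
Adj B z z' = z ∈ B × z' ∈ B × Meet z z'

record OuterBetti (d : ℕ) (B : List (Fact d)) : Set where
  field
    nil     : ∀ z → z ∈ B → eval d z ≡ nothing
    cond-i  : ∀ i → InSupp B i →
              Σ ℕ λ q → q ℕ.< m d ×
                (∀ w → (w ∈ B -e i → eval d w ≡ just q) × (eval d w ≡ just q → w ∈ B -e i))
    cond-ii : ∀ z z' → z ∈ B → z' ∈ B → Star (Adj B) z z'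

InH : (d : ℕ) → Vec ℚ d → Set
InH d x = ∀ q → q ℕ.< m d → ∀ c c' →
  eval d c ≡ just q → eval d c' ≡ just q → dot c x ≡ dot c' x

InF : (d : ℕ) → Vec ℚ d → Set
InF d x = InH d x ×
  (∀ B → OuterBetti d B → ∀ z → z ∈ B → ∀ a →
     eval d a ≡ just (zbar d z) → dot a x ≤ dot z x)

-- cone over a (d-1)-cube: 0 ≤ y_i ≤ y_{d-1} for i < d-1 (last coordinate = t)

InCubeCone : (d : ℕ) → Vec ℚ d → Set
InCubeCone d y = ∀ i j → toℕ j ≡ d ∸ 1 → toℕ i ℕ.< d ∸ 1 →
  0ℚ ≤ lookup y i × lookup y i ≤ lookup y j

Matrix : ℕ → Set
Matrix d = Vec (Vec ℚ d) d

dotℚ : {n : ℕ} → Vec ℚ n → Vec ℚ n → ℚ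
dotℚ [] [] = 0ℚ
dotℚ (a ∷ as) (b ∷ bs) = a * b + dotℚ as bs

apply : {d : ℕ} → Matrix d → Vec ℚ d → Vec ℚ d
apply M x = map (λ row → dotℚ row x) M

Invertible : {d : ℕ} → Matrix d → Set
Invertible {d} M = Σ (Matrix d) λ M' →
  (∀ x → apply M' (apply M x) ≡ x) × (∀ y → apply M (apply M' y) ≡ y)

{-# OPTIONS --safe #-}
-- Write K = d - 1, so m = 3K. Every non-nil element q of N has exactly one factorization Φ q:
-- a multiple of the atom 1, a single middle atom, or a multiple of the atom m - 1. Hence H_N is
-- the whole space, and the Betti inequality of z at x reads ψ z̄ ≤ z · x, where ψ q = Φ q · x.
-- With s = x₁ and t = x_d, ψ q = q s on [0, K] and ψ q = (3K - q) t on [2K, 3K]; on the middle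
-- segment [K, 2K] it is unconstrained. The invertible linear map
--   y_r = s + ψ (K + r) - ψ (K + r + 1)  for r < K,      y_K = s + t
-- turns the cube conditions 0 ≤ y_r ≤ y_K into the unit steps ψ (q + 1) ≤ ψ q + s and
-- ψ q ≤ ψ (q + 1) + t across the middle segment, and the outer Betti elements {e_i + e_j} and
-- {d e_i} yield exactly these steps. Conversely the steps then hold all around ℤ_m, because
-- s + t ≥ 0; walking one unit at a time to the corners K and 2K shows that ψ is subadditive,
-- and subadditivity gives every Betti inequality.
module Submission where

open import Defs
open import Data.Nat using (ℕ; zero; suc; _≤_; _<_; z≤n; s≤s; _≡ᵇ_; _≤ᵇ_; _<ᵇ_; _%_)
  renaming (_+_ to _+ℕ_; _*_ to _*ℕ_; _∸_ to _∸ℕ_)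
import Data.Nat as Nat
import Data.Nat.Properties as ℕP
import Data.Nat.DivMod as ℕD
open import Data.Nat.Coprimality using (1-coprimeTo) renaming (sym to coprime-sym)
import Data.Integer as ℤ
import Data.Integer.Properties as ℤP
open import Data.Rational using (ℚ; mkℚ; 0ℚ; 1ℚ; 1/_; toℚᵘ) renaming (_≤_ to _≤ℚ_)
import Data.Rational.Properties as ℚP
import Data.Rational.Unnormalised as ℚᵘ
import Data.Rational.Unnormalised.Properties as ℚᵘP
open import Data.Bool using (true; false; T; if_then_else_; _∧_; _∨_)
import Data.Bool.Properties as BoolP
open import Data.Empty using (⊥-elim)
open import Data.Maybe using (Maybe; just; nothing)
open import Data.Maybe.Properties using (just-injective)
open import Data.Fin using (Fin; toℕ; fromℕ<) renaming (zero to fzero; suc to fsuc)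
open import Data.Fin.Properties using (toℕ-fromℕ<)
open import Data.Vec using (Vec; []; _∷_; lookup; map; tabulate; updateAt)
import Data.Vec.Properties as VecP
open import Data.List using ([_])
open import Data.List.Relation.Unary.Any using (here)
open import Data.List.Membership.Propositional using (_∈_)
open import Data.Product using (Σ; ∃; _×_; _,_; proj₁; proj₂)
open import Data.Sum using (_⊎_; inj₁; inj₂)
open import Function using (_∘_; _$_; Equivalence)
open import Level using (0ℓ)
open import Relation.Nullary using (¬_; yes; no)
open import Relation.Binary.Definitions using (tri<; tri≈; tri>)
open import Relation.Binary.Construct.Closure.ReflexiveTransitive using (Star; ε)
open import Relation.Binary.PropositionalEquality hiding ([_])
open import Tactic.RingSolver using (solve-∀)
open import Tactic.RingSolver.Core.AlmostCommutativeRing using (AlmostCommutativeRing; fromCommutativeRing)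
open import Data.Nat.Tactic.RingSolver using () renaming (solve-∀ to solveℕ-∀)

vec : ∀ {A : Set} n → (ℕ → A) → Vec A n
vec zero f = []
vec (suc n) f = f 0 ∷ vec n (f ∘ suc)

-- Out-of-range indices read the default value.
lookupOr : ∀ {A : Set} {n} → A → Vec A n → ℕ → A
lookupOr a [] j = a
lookupOr a (b ∷ v) zero = b
lookupOr a (b ∷ v) (suc j) = lookupOr a v j

vec-lookupOr : ∀ {A : Set} {n} (a : A) (v : Vec A n) → v ≡ vec n (lookupOr a v)
vec-lookupOr a [] = refl
vec-lookupOr a (b ∷ v) = cong (b ∷_) (vec-lookupOr a v)

lookupOr-vec : ∀ {A : Set} {n} (a : A) (f : ℕ → A) {j} → j < n → lookupOr a (vec n f) j ≡ f j
lookupOr-vec {n = suc n} a f {zero} _ = refl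
lookupOr-vec {n = suc n} a f {suc j} (s≤s j<n) = lookupOr-vec a (f ∘ suc) j<n

vec-cong : ∀ {A : Set} n {f g : ℕ → A} → (∀ j → j < n → f j ≡ g j) → vec n f ≡ vec n g
vec-cong zero f≗g = refl
vec-cong (suc n) f≗g = cong₂ _∷_ (f≗g 0 (s≤s z≤n)) (vec-cong n (λ j j<n → f≗g (suc j) (s≤s j<n)))

vec-ext : ∀ {A : Set} n (a : A) {u v : Vec A n} → (∀ j → j < n → lookupOr a u j ≡ lookupOr a v j) → u ≡ v
vec-ext n a {u} {v} u≗v = trans (vec-lookupOr a u) (trans (vec-cong n u≗v) (sym (vec-lookupOr a v)))

map-vec : ∀ {A B : Set} n (f : A → B) (g : ℕ → A) → map f (vec n g) ≡ vec n (f ∘ g)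
map-vec zero f g = refl
map-vec (suc n) f g = cong (f (g 0) ∷_) (map-vec n f (g ∘ suc))

lookup-vec : ∀ {A : Set} {n} (f : ℕ → A) (i : Fin n) → lookup (vec n f) i ≡ f (toℕ i)
lookup-vec f fzero = refl
lookup-vec f (fsuc i) = lookup-vec (f ∘ suc) i

lookup≡lookupOr : ∀ {A : Set} {n} (a : A) (v : Vec A n) (i : Fin n) → lookup v i ≡ lookupOr a v (toℕ i)
lookup≡lookupOr a (b ∷ v) fzero = refl
lookup≡lookupOr a (b ∷ v) (fsuc i) = lookup≡lookupOr a v i

tabulate-vec : ∀ {A : Set} {n} (f : Fin n → A) (g : ℕ → A) → (∀ i → f i ≡ g (toℕ i)) → tabulate f ≡ vec n g
tabulate-vec {n = zero} f g f≗g = refl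
tabulate-vec {n = suc n} f g f≗g = cong₂ _∷_ (f≗g fzero) (tabulate-vec (f ∘ fsuc) (g ∘ suc) (f≗g ∘ fsuc))

updateAt-vec : ∀ {A : Set} {n} (f : ℕ → A) (i : Fin n) (h : A → A) →
               updateAt (vec n f) i h ≡ vec n (λ j → if j ≡ᵇ toℕ i then h (f j) else f j)
updateAt-vec f fzero h = refl
updateAt-vec f (fsuc i) h = cong (f 0 ∷_) (updateAt-vec (f ∘ suc) i h)

T⇒≡true : ∀ {b} → T b → b ≡ true
T⇒≡true = Equivalence.to BoolP.T-≡

¬T⇒≡false : ∀ {b} → ¬ T b → b ≡ false
¬T⇒≡false {false} _ = refl
¬T⇒≡false {true} ¬t = ⊥-elim (¬t _)

≡ᵇ-true : ∀ {i j} → i ≡ j → (i ≡ᵇ j) ≡ true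
≡ᵇ-true {i} {j} i≡j = T⇒≡true (ℕP.≡⇒≡ᵇ i j i≡j)

≡ᵇ-false : ∀ {i j} → i ≢ j → (i ≡ᵇ j) ≡ false
≡ᵇ-false {i} {j} i≢j = ¬T⇒≡false (i≢j ∘ ℕP.≡ᵇ⇒≡ i j)

≤ᵇ-true : ∀ {i j} → i ≤ j → (i ≤ᵇ j) ≡ true
≤ᵇ-true i≤j = T⇒≡true (ℕP.≤⇒≤ᵇ i≤j)

≤ᵇ-false : ∀ {i j} → ¬ i ≤ j → (i ≤ᵇ j) ≡ false
≤ᵇ-false {i} {j} i≰j = ¬T⇒≡false (i≰j ∘ ℕP.≤ᵇ⇒≤ i j)

<ᵇ-true : ∀ {i j} → i < j → (i <ᵇ j) ≡ true
<ᵇ-true i<j = T⇒≡true (ℕP.<⇒<ᵇ i<j)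

<ᵇ-false : ∀ {i j} → ¬ i < j → (i <ᵇ j) ≡ false
<ᵇ-false {i} {j} i≮j = ¬T⇒≡false (i≮j ∘ ℕP.<ᵇ⇒< i j)

_·e_ : ℕ → ℕ → ℕ → ℕ
(c ·e a) j = if j ≡ᵇ a then c else 0

·e-at : ∀ c a → (c ·e a) a ≡ c
·e-at c a rewrite ≡ᵇ-true {a} refl = refl

·e-off : ∀ c a {j} → j ≢ a → (c ·e a) j ≡ 0
·e-off c a j≢a rewrite ≡ᵇ-false j≢a = refl

·e-support : ∀ c a j → 0 < (c ·e a) j → j ≡ a
·e-support c a j pos with j ≡ᵇ a in eq
... | true = ℕP.≡ᵇ⇒≡ j a (subst T (sym eq) _)
... | false = ⊥-elim (ℕP.<-irrefl refl pos)

·e-≤ : ∀ c a j → (c ·e a) j ≤ c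
·e-≤ c a j with j ≡ᵇ a
... | true = ℕP.≤-refl
... | false = z≤n

if-true : ∀ {A : Set} {b} {x y : A} → b ≡ true → (if b then x else y) ≡ x
if-true refl = refl

if-false : ∀ {A : Set} {b} {x y : A} → b ≡ false → (if b then x else y) ≡ y
if-false refl = refl

dotℕ-·e : ∀ n c a (P : Vec ℕ n) → a < n → dotℕ (vec n (c ·e a)) P ≡ c *ℕ lookupOr 0 P a
dotℕ-·e (suc n) c zero (p ∷ P) _ = trans (cong ((c *ℕ p) +ℕ_) (dotℕ-zero n P)) (ℕP.+-identityʳ _)
  where
  dotℕ-zero : ∀ n (P : Vec ℕ n) → dotℕ (vec n (λ _ → 0)) P ≡ 0
  dotℕ-zero zero [] = refl
  dotℕ-zero (suc n) (p ∷ P) = dotℕ-zero n P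
dotℕ-·e (suc n) c (suc a) (p ∷ P) (s≤s a<n) = dotℕ-·e n c a P a<n

dotℕ-+ : ∀ n (f g : ℕ → ℕ) (P : Vec ℕ n) → dotℕ (vec n (λ j → f j +ℕ g j)) P ≡ dotℕ (vec n f) P +ℕ dotℕ (vec n g) P
dotℕ-+ zero f g [] = refl
dotℕ-+ (suc n) f g (p ∷ P) rewrite dotℕ-+ n (f ∘ suc) (g ∘ suc) P = e (f 0) (g 0) p _ _
  where
  e : ∀ a b p u v → (a +ℕ b) *ℕ p +ℕ (u +ℕ v) ≡ (a *ℕ p +ℕ u) +ℕ (b *ℕ p +ℕ v)
  e = solveℕ-∀

module Rationals where
  open import Data.Rational using (_+_; _*_; _-_; -_)

  ℚ-ring : AlmostCommutativeRing 0ℓ 0ℓ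
  ℚ-ring = fromCommutativeRing ℚP.+-*-commutativeRing is-zero
    where
    is-zero : (p : ℚ) → Maybe (0ℚ ≡ p)
    is-zero p with 0ℚ ℚP.≟ p
    ... | yes 0≡p = just 0≡p
    ... | no _ = nothing

  toℚ≡mkℚ : ∀ n → toℚ n ≡ mkℚ (ℤ.+ n) 0 (coprime-sym (1-coprimeTo n))
  toℚ≡mkℚ n = ℚP.normalize-coprime (coprime-sym (1-coprimeTo n))

  toℚᵘ-toℚ : ∀ n → toℚᵘ (toℚ n) ≡ ℚᵘ.mkℚᵘ (ℤ.+ n) 0
  toℚᵘ-toℚ n rewrite toℚ≡mkℚ n = refl

  toℚ-+ : ∀ a b → toℚ (a +ℕ b) ≡ toℚ a + toℚ b
  toℚ-+ a b = ℚP.toℚᵘ-injective (ℚᵘP.≃-trans (ℚᵘP.≃-reflexive (toℚᵘ-toℚ (a +ℕ b)))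
                                  (ℚᵘP.≃-trans sum (ℚᵘP.≃-sym (ℚP.toℚᵘ-homo-+ (toℚ a) (toℚ b)))))
    where
    sum : ℚᵘ.mkℚᵘ (ℤ.+ (a +ℕ b)) 0 ℚᵘ.≃ (toℚᵘ (toℚ a) ℚᵘ.+ toℚᵘ (toℚ b))
    sum rewrite toℚᵘ-toℚ a | toℚᵘ-toℚ b =
      ℚᵘ.*≡* (trans (ℤP.*-identityʳ _) (sym (trans (ℤP.*-identityʳ _)
        (trans (cong₂ ℤ._+_ (ℤP.*-identityʳ (ℤ.+ a)) (ℤP.*-identityʳ (ℤ.+ b))) (sym (ℤP.pos-+ a b))))))

  toℚ-suc : ∀ n → toℚ (suc n) ≡ 1ℚ + toℚ n
  toℚ-suc = toℚ-+ 1

  ≤-by-slack : ∀ {a b} d → 0ℚ ≤ℚ d → b ≡ a + d → a ≤ℚ b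
  ≤-by-slack {a} {b} d 0≤d b≡a+d = subst (_≤ℚ b) (ℚP.+-identityʳ a) (subst (a + 0ℚ ≤ℚ_) (sym b≡a+d) (ℚP.+-monoʳ-≤ a 0≤d))

  slack : ∀ {a b} → a ≤ℚ b → 0ℚ ≤ℚ b - a
  slack {a} {b} a≤b = subst (_≤ℚ b - a) (ℚP.+-inverseʳ a) (ℚP.+-monoˡ-≤ (- a) a≤b)

  +-cancelˡ-≤ : ∀ a {b c} → a + b ≤ℚ a + c → b ≤ℚ c
  +-cancelˡ-≤ a {b} {c} le = subst₂ _≤ℚ_ (e a b) (e a c) (ℚP.+-monoʳ-≤ (- a) le)
    where
    e : ∀ a b → - a + (a + b) ≡ b
    e = solve-∀ ℚ-ring

  c≤b+a⇒0≤a+b-c : ∀ a b c → c ≤ℚ b + a → 0ℚ ≤ℚ a + b - c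
  c≤b+a⇒0≤a+b-c a b c le = ≤-by-slack (b + a - c) (slack le) (e a b c)
    where
    e : ∀ a b c → a + b - c ≡ 0ℚ + (b + a - c)
    e = solve-∀ ℚ-ring

  0≤a+b-c⇒c≤b+a : ∀ a b c → 0ℚ ≤ℚ a + b - c → c ≤ℚ b + a
  0≤a+b-c⇒c≤b+a a b c le = ≤-by-slack (a + b - c) le (e a b c)
    where
    e : ∀ a b c → b + a ≡ c + (a + b - c)
    e = solve-∀ ℚ-ring

  b≤c+d⇒a+b-c≤a+d : ∀ a b c d → b ≤ℚ c + d → a + b - c ≤ℚ a + d
  b≤c+d⇒a+b-c≤a+d a b c d le = ≤-by-slack (c + d - b) (slack le) (e a b c d)
    where
    e : ∀ a b c d → a + d ≡ a + b - c + (c + d - b)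
    e = solve-∀ ℚ-ring

  a+b-c≤a+d⇒b≤c+d : ∀ a b c d → a + b - c ≤ℚ a + d → b ≤ℚ c + d
  a+b-c≤a+d⇒b≤c+d a b c d le = ≤-by-slack (a + d - (a + b - c)) (slack le) (e a b c d)
    where
    e : ∀ a b c d → c + d ≡ b + (a + d - (a + b - c))
    e = solve-∀ ℚ-ring

  coord : ∀ {n} → Vec ℚ n → ℕ → ℚ
  coord = lookupOr 0ℚ

  dot-zero : ∀ n (x : Vec ℚ n) → dot (vec n (λ _ → 0)) x ≡ 0ℚ
  dot-zero zero [] = refl
  dot-zero (suc n) (x ∷ xs) = trans (cong ((0ℚ * x) +_) (dot-zero n xs)) (e x)
    where
    e : ∀ x → 0ℚ * x + 0ℚ ≡ 0ℚ
    e = solve-∀ ℚ-ring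

  dot-·e : ∀ n c a (x : Vec ℚ n) → a < n → dot (vec n (c ·e a)) x ≡ toℚ c * coord x a
  dot-·e (suc n) c zero (x ∷ xs) _ = trans (cong ((toℚ c * x) +_) (dot-zero n xs)) (ℚP.+-identityʳ _)
  dot-·e (suc n) c (suc a) (x ∷ xs) (s≤s a<n) = trans (e x _) (dot-·e n c a xs a<n)
    where
    e : ∀ x y → 0ℚ * x + y ≡ y
    e = solve-∀ ℚ-ring

  dot-+ : ∀ n (f g : ℕ → ℕ) (x : Vec ℚ n) → dot (vec n (λ j → f j +ℕ g j)) x ≡ dot (vec n f) x + dot (vec n g) x
  dot-+ zero f g [] = sym (ℚP.+-identityʳ 0ℚ)
  dot-+ (suc n) f g (x ∷ xs) =
    trans (cong₂ (λ c d → c * x + d) (toℚ-+ (f 0) (g 0)) (dot-+ n (f ∘ suc) (g ∘ suc) xs)) (e (toℚ (f 0)) (toℚ (g 0)) x _ _)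
    where
    e : ∀ a b x u v → (a + b) * x + (u + v) ≡ (a * x + u) + (b * x + v)
    e = solve-∀ ℚ-ring

  dotℚ-+ : ∀ n (f g : ℕ → ℚ) (x : Vec ℚ n) → dotℚ (vec n (λ j → f j + g j)) x ≡ dotℚ (vec n f) x + dotℚ (vec n g) x
  dotℚ-+ zero f g [] = sym (ℚP.+-identityʳ 0ℚ)
  dotℚ-+ (suc n) f g (x ∷ xs) = trans (cong ((f 0 + g 0) * x +_) (dotℚ-+ n (f ∘ suc) (g ∘ suc) xs)) (e (f 0) (g 0) x _ _)
    where
    e : ∀ a b x u v → (a + b) * x + (u + v) ≡ (a * x + u) + (b * x + v)
    e = solve-∀ ℚ-ring

  dotℚ-diff : ∀ n (f g : ℕ → ℚ) (x : Vec ℚ n) → dotℚ (vec n (λ j → f j - g j)) x ≡ dotℚ (vec n f) x - dotℚ (vec n g) x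
  dotℚ-diff zero f g [] = refl
  dotℚ-diff (suc n) f g (x ∷ xs) = trans (cong ((f 0 - g 0) * x +_) (dotℚ-diff n (f ∘ suc) (g ∘ suc) xs)) (e (f 0) (g 0) x _ _)
    where
    e : ∀ a b x u v → (a - b) * x + (u - v) ≡ (a * x + u) - (b * x + v)
    e = solve-∀ ℚ-ring

  dotℚ-* : ∀ n a (f : ℕ → ℚ) (x : Vec ℚ n) → dotℚ (vec n (λ j → a * f j)) x ≡ a * dotℚ (vec n f) x
  dotℚ-* zero a f [] = sym (ℚP.*-zeroʳ a)
  dotℚ-* (suc n) a f (x ∷ xs) = trans (cong ((a * f 0) * x +_) (dotℚ-* n a (f ∘ suc) xs)) (e a (f 0) x _)
    where
    e : ∀ a b x u → a * b * x + a * u ≡ a * (b * x + u)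
    e = solve-∀ ℚ-ring

  dotℚ-toℚ : ∀ n (f : ℕ → ℕ) (x : Vec ℚ n) → dotℚ (vec n (toℚ ∘ f)) x ≡ dot (vec n f) x
  dotℚ-toℚ zero f [] = refl
  dotℚ-toℚ (suc n) f (x ∷ xs) = cong (toℚ (f 0) * x +_) (dotℚ-toℚ n (f ∘ suc) xs)

  prefix : ℕ → ℕ → ℕ
  prefix p j = if j <ᵇ p then 1 else 0

  partialSum : ∀ {n} → Vec ℚ n → ℕ → ℚ
  partialSum y zero = 0ℚ
  partialSum y (suc p) = partialSum y p + coord y p

  dot-prefix : ∀ n p (y : Vec ℚ n) → p ≤ n → dot (vec n (prefix p)) y ≡ partialSum y p
  dot-prefix n zero y _ = dot-zero n y
  dot-prefix n (suc p) y p<n = begin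
    dot (vec n (prefix (suc p))) y                                  ≡⟨ cong (λ v → dot v y) (vec-cong n split) ⟩
    dot (vec n (λ j → prefix p j +ℕ (1 ·e p) j)) y               ≡⟨ dot-+ n (prefix p) (1 ·e p) y ⟩
    dot (vec n (prefix p)) y + dot (vec n (1 ·e p)) y               ≡⟨ cong₂ _+_ (dot-prefix n p y (ℕP.<⇒≤ p<n)) (dot-·e n 1 p y p<n) ⟩
    partialSum y p + toℚ 1 * coord y p                              ≡⟨ cong (partialSum y p +_) (ℚP.*-identityˡ (coord y p)) ⟩
    partialSum y (suc p)                                            ∎
    where
    open ≡-Reasoning
    split : ∀ j → j < n → prefix (suc p) j ≡ prefix p j +ℕ (1 ·e p) j
    split j _ with ℕP.<-cmp j p
    ... | tri< j<p j≢p _ rewrite <ᵇ-true (ℕP.m<n⇒m<1+n j<p) | <ᵇ-true j<p | ≡ᵇ-false j≢p = refl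
    ... | tri≈ _ refl _ rewrite <ᵇ-true (ℕP.n<1+n j) | <ᵇ-false (ℕP.n≮n j) | ≡ᵇ-true {j} refl = refl
    ... | tri> _ j≢p p<j rewrite <ᵇ-false (ℕP.<⇒≱ (s≤s p<j)) | <ᵇ-false (ℕP.<⇒≯ p<j) | ≡ᵇ-false j≢p = refl

  telescope : ∀ {n} (y : Vec ℚ n) c (u : ℕ → ℚ) m → (∀ r → r < m → coord y r ≡ c + u r - u (suc r)) →
              partialSum y m ≡ toℚ m * c + u 0 - u m
  telescope y c u zero _ = e c (u 0)
    where
    e : ∀ c a → 0ℚ ≡ 0ℚ * c + a - a
    e = solve-∀ ℚ-ring
  telescope y c u (suc m) steps = begin
    partialSum y m + coord y m                                  ≡⟨ cong₂ _+_ (telescope y c u m (λ r r<m → steps r (ℕP.m<n⇒m<1+n r<m))) (steps m (ℕP.n<1+n m)) ⟩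
    (toℚ m * c + u 0 - u m) + (c + u m - u (suc m))             ≡⟨ e (toℚ m) c (u 0) (u m) (u (suc m)) ⟩
    (1ℚ + toℚ m) * c + u 0 - u (suc m)                          ≡⟨ cong (λ a → a * c + u 0 - u (suc m)) (sym (toℚ-suc m)) ⟩
    toℚ (suc m) * c + u 0 - u (suc m)                           ∎
    where
    open ≡-Reasoning
    e : ∀ m c a b b′ → (m * c + a - b) + (c + b - b′) ≡ (1ℚ + m) * c + a - b′
    e = solve-∀ ℚ-ring

  matrix : ∀ n → (ℕ → ℕ → ℚ) → Vec (Vec ℚ n) n
  matrix n rows = vec n (λ r → vec n (rows r))

  coord-apply-matrix : ∀ n (rows : ℕ → ℕ → ℚ) (x : Vec ℚ n) r → r < n →
                       coord (map (λ row → dotℚ row x) (matrix n rows)) r ≡ dotℚ (vec n (rows r)) x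
  coord-apply-matrix n rows x r r<n =
    trans (cong (λ v → coord v r) (map-vec n (λ row → dotℚ row x) (λ r → vec n (rows r)))) (lookupOr-vec 0ℚ _ r<n)

  module _ (f : ℕ → ℚ) (subadditive : ∀ a b → f (a +ℕ b) ≤ℚ f a + f b) (f0≤0 : f 0 ≤ℚ 0ℚ) where
    open ℚP.≤-Reasoning

    subadditive-* : ∀ c p → f (c *ℕ p) ≤ℚ toℚ c * f p
    subadditive-* zero p = ℚP.≤-trans f0≤0 (ℚP.≤-reflexive (sym (ℚP.*-zeroˡ (f p))))
    subadditive-* (suc c) p = begin
      f (p +ℕ c *ℕ p)       ≤⟨ subadditive p (c *ℕ p) ⟩
      f p + f (c *ℕ p)      ≤⟨ ℚP.+-monoʳ-≤ (f p) (subadditive-* c p) ⟩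
      f p + toℚ c * f p     ≡⟨ e (toℚ c) (f p) ⟩
      (1ℚ + toℚ c) * f p    ≡⟨ cong (_* f p) (sym (toℚ-suc c)) ⟩
      toℚ (suc c) * f p     ∎
      where
      e : ∀ c a → a + c * a ≡ (1ℚ + c) * a
      e = solve-∀ ℚ-ring

    subadditive-dot : ∀ {n} (z P : Vec ℕ n) → f (dotℕ z P) ≤ℚ dot z (map f P)
    subadditive-dot [] [] = f0≤0
    subadditive-dot (c ∷ z) (p ∷ P) = begin
      f (c *ℕ p +ℕ dotℕ z P)           ≤⟨ subadditive (c *ℕ p) (dotℕ z P) ⟩
      f (c *ℕ p) + f (dotℕ z P)        ≤⟨ ℚP.+-mono-≤ (subadditive-* c p) (subadditive-dot z P) ⟩
      toℚ c * f p + dot z (map f P)    ∎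

open Rationals

module CupSemigroup (k : ℕ) where
  open import Data.Nat using (_+_; _*_; _∸_)

  K : ℕ
  K = suc (suc k)

  D : ℕ
  D = suc K

  M : ℕ
  M = m D

  neg1 : ℕ
  neg1 = M ∸ 1

  infixl 6 _⊕_
  _⊕_ : Elt → Elt → Elt
  x ⊕ y = x ⊕⟨ D ⟩ y

  M≡K+K+K : M ≡ K + K + K
  M≡K+K+K = e k
    where
    e : ∀ k → (2 + k) + ((2 + k) + ((2 + k) + 0)) ≡ (2 + k) + (2 + k) + (2 + k)
    e = solveℕ-∀

  K<K+K : K < K + K
  K<K+K = ℕP.m<m+n K (s≤s z≤n)

  K+K<M : K + K < M
  K+K<M = subst (K + K <_) (sym M≡K+K+K) (ℕP.m<m+n (K + K) (s≤s z≤n))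

  K<M : K < M
  K<M = ℕP.<-trans K<K+K K+K<M

  M∸K : M ∸ K ≡ K + K
  M∸K = trans (ℕP.m+n∸m≡n K (K + (K + 0))) (cong (K +_) (ℕP.+-identityʳ K))

  M∸[K+K] : M ∸ (K + K) ≡ K
  M∸[K+K] = trans (cong (_∸ (K + K)) M≡K+K+K) (ℕP.m+n∸m≡n (K + K) K)

  M∸D+1 : M ∸ D + 1 ≡ K + K
  M∸D+1 = trans (cong (λ n → n ∸ D + 1) (e₁ k)) (trans (cong (_+ 1) (ℕP.m+n∸m≡n D (K + suc k))) (e₂ k))
    where
    e₁ : ∀ k → (2 + k) + ((2 + k) + ((2 + k) + 0)) ≡ (3 + k) + ((2 + k) + suc k)
    e₁ = solveℕ-∀
    e₂ : ∀ k → (2 + k) + suc k + 1 ≡ (2 + k) + (2 + k)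
    e₂ = solveℕ-∀

  K+K≤neg1 : K + K ≤ neg1
  K+K≤neg1 = ℕP.≤-pred K+K<M

  K<neg1 : K < neg1
  K<neg1 = ℕP.<-≤-trans K<K+K K+K≤neg1

  M∸neg1 : M ∸ neg1 ≡ 1
  M∸neg1 = ℕP.m∸[m∸n]≡n {M} {1} (s≤s z≤n)

  M∸<M : ∀ c → 0 < c → M ∸ c < M
  M∸<M (suc c) _ = s≤s (ℕP.m∸n≤m neg1 c)

  reduce-< : ∀ s → s < M → reduce D s ≡ s
  reduce-< s s<M rewrite <ᵇ-true s<M = refl

  reduce-≥ : ∀ s → ¬ s < M → reduce D s ≡ s ∸ M
  reduce-≥ s s≮M rewrite <ᵇ-false s≮M = refl

  low-true : ∀ a → 0 < a → a ≤ K → low D a ≡ true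
  low-true a 0<a a≤K rewrite ≤ᵇ-true 0<a | ≤ᵇ-true a≤K = refl

  low-false : ∀ a → K < a → low D a ≡ false
  low-false a K<a rewrite ≤ᵇ-false (ℕP.<⇒≱ K<a) = BoolP.∧-zeroʳ (1 ≤ᵇ a)

  high-true : ∀ a → K + K ≤ a → a < M → high D a ≡ true
  high-true a K+K≤a a<M rewrite M∸D+1 | ≤ᵇ-true K+K≤a | ≤ᵇ-true (ℕP.≤-pred a<M) = refl

  high-false : ∀ a → a < K + K → high D a ≡ false
  high-false a a<K+K rewrite M∸D+1 | ≤ᵇ-false (ℕP.<⇒≱ a<K+K) = refl

  ⊕-defined : ∀ a b → defined D a b ≡ true → just a ⊕ just b ≡ just (reduce D (a + b))
  ⊕-defined a b def rewrite def = refl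

  ⊕-undefined : ∀ a b → defined D a b ≡ false → just a ⊕ just b ≡ nothing
  ⊕-undefined a b undef rewrite undef = refl

  ⊕-identityˡ : ∀ b → b < M → just 0 ⊕ just b ≡ just b
  ⊕-identityˡ b b<M = trans (⊕-defined 0 b refl) (cong just (reduce-< b b<M))

  ⊕-identityʳ : ∀ a → a < M → just a ⊕ just 0 ≡ just a
  ⊕-identityʳ a a<M = trans (⊕-defined a 0 (BoolP.∨-zeroʳ (a ≡ᵇ 0)))
                             (cong just (trans (cong (reduce D) (ℕP.+-identityʳ a)) (reduce-< a a<M)))

  defined-low : ∀ a b → low D a ≡ true → low D b ≡ true → (a + b ≤ᵇ K) ≡ true → defined D a b ≡ true
  defined-low a b la lb ab rewrite la | lb | ab | BoolP.∨-zeroʳ (b ≡ᵇ 0) = BoolP.∨-zeroʳ (a ≡ᵇ 0)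

  defined-high : ∀ a b → high D a ≡ true → high D b ≡ true → ((M ∸ a) + (M ∸ b) ≤ᵇ K) ≡ true → defined D a b ≡ true
  defined-high a b ha hb ab rewrite ha | hb | ab | BoolP.∨-zeroʳ (low D a ∧ low D b ∧ (a + b ≤ᵇ K)) | BoolP.∨-zeroʳ (b ≡ᵇ 0) =
    BoolP.∨-zeroʳ (a ≡ᵇ 0)

  undefined-mid : ∀ a b → low D (suc a) ≡ false → high D (suc a) ≡ false → defined D (suc a) (suc b) ≡ false
  undefined-mid a b la ha rewrite la | ha = refl

  undefined-low-big : ∀ a b → high D (suc a) ≡ false → low D (suc b) ≡ false → defined D (suc a) (suc b) ≡ false
  undefined-low-big a b ha lb rewrite ha | lb = trans (BoolP.∨-identityʳ _) (BoolP.∧-zeroʳ (low D (suc a)))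

  undefined-low : ∀ a b → low D (suc a) ≡ true → low D (suc b) ≡ true → (suc a + suc b ≤ᵇ K) ≡ false →
                  high D (suc a) ≡ false → defined D (suc a) (suc b) ≡ false
  undefined-low a b la lb ab ha rewrite la | lb | ab | ha = refl

  undefined-high : ∀ a b → high D (suc a) ≡ true → high D (suc b) ≡ true → ((M ∸ suc a) + (M ∸ suc b) ≤ᵇ K) ≡ false →
                   low D (suc a) ≡ false → defined D (suc a) (suc b) ≡ false
  undefined-high a b ha hb ab la rewrite ha | hb | ab | la = refl

  times-1 : ∀ a → a ≤ K → times D a (just 1) ≡ just a
  times-1 zero _ = refl
  times-1 (suc zero) _ = ⊕-identityʳ 1 (ℕP.<-trans (s≤s (s≤s z≤n)) K<M)
  times-1 (suc (suc a)) a+2≤K =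
    begin
      just 1 ⊕ times D (suc a) (just 1)  ≡⟨ cong (just 1 ⊕_) (times-1 (suc a) a+1≤K) ⟩
      just 1 ⊕ just (suc a)              ≡⟨ ⊕-defined 1 (suc a) 1⊕a-defined ⟩
      just (reduce D (suc (suc a)))      ≡⟨ cong just (reduce-< _ (ℕP.≤-<-trans a+2≤K K<M)) ⟩
      just (suc (suc a))                 ∎
    where
    open ≡-Reasoning
    a+1≤K = ℕP.<⇒≤ a+2≤K
    1⊕a-defined = defined-low 1 (suc a) (low-true 1 (s≤s z≤n) (s≤s z≤n)) (low-true (suc a) (s≤s z≤n) a+1≤K) (≤ᵇ-true a+2≤K)

  times-1-nil : ∀ a → K < a → times D a (just 1) ≡ nothing
  times-1-nil (suc a) (s≤s K≤a) with ℕP.m≤n⇒m<n∨m≡n K≤a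
  ... | inj₁ K<a rewrite times-1-nil a K<a = refl
  ... | inj₂ refl rewrite times-1 K ℕP.≤-refl =
    ⊕-undefined 1 K (undefined-low 0 (suc k) (low-true 1 (s≤s z≤n) (s≤s z≤n)) (low-true K (s≤s z≤n) ℕP.≤-refl)
                                    (≤ᵇ-false (ℕP.n≮n K)) (high-false 1 (s≤s (s≤s z≤n))))

  times-neg1 : ∀ c → 0 < c → c ≤ K → times D c (just neg1) ≡ just (M ∸ c)
  times-neg1 (suc zero) _ _ = ⊕-identityʳ neg1 ℕP.≤-refl
  times-neg1 (suc (suc c)) _ c+2≤K =
    begin
      just neg1 ⊕ times D (suc c) (just neg1)  ≡⟨ cong (just neg1 ⊕_) (times-neg1 (suc c) (s≤s z≤n) c+1≤K) ⟩
      just neg1 ⊕ just (M ∸ suc c)             ≡⟨ ⊕-defined neg1 (M ∸ suc c) neg1⊕-defined ⟩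
      just (reduce D (neg1 + (M ∸ suc c)))     ≡⟨ cong just (trans (reduce-≥ _ M≤sum) sum∸M) ⟩
      just (M ∸ suc (suc c))                   ∎
    where
    open ≡-Reasoning
    c+1≤K = ℕP.<⇒≤ c+2≤K
    c+1<M = ℕP.≤-<-trans c+1≤K K<M
    K+K≤M∸[c+1] : K + K ≤ M ∸ suc c
    K+K≤M∸[c+1] = subst (_≤ M ∸ suc c) M∸K (ℕP.∸-monoʳ-≤ M c+1≤K)
    neg1⊕-defined = defined-high neg1 (M ∸ suc c) (high-true neg1 K+K≤neg1 ℕP.≤-refl) (high-true _ K+K≤M∸[c+1] (M∸<M (suc c) (s≤s z≤n)))
                      (trans (cong₂ (λ a b → a + b ≤ᵇ K) M∸neg1 (ℕP.m∸[m∸n]≡n (ℕP.<⇒≤ c+1<M))) (≤ᵇ-true c+2≤K))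
    M∸[c+1]≡ : M ∸ suc c ≡ suc (M ∸ suc (suc c))
    M∸[c+1]≡ = ℕP.+-∸-assoc 1 {neg1} {suc c} (ℕP.<⇒≤ (ℕP.<-trans c+2≤K K<neg1))
    sum≡ : neg1 + (M ∸ suc c) ≡ M + (M ∸ suc (suc c))
    sum≡ = trans (cong (neg1 +_) M∸[c+1]≡) (ℕP.+-suc neg1 _)
    M≤sum : ¬ neg1 + (M ∸ suc c) < M
    M≤sum lt = ℕP.<⇒≱ lt (subst (M ≤_) (sym sum≡) (ℕP.m≤m+n M _))
    sum∸M : neg1 + (M ∸ suc c) ∸ M ≡ M ∸ suc (suc c)
    sum∸M = trans (cong (_∸ M) sum≡) (ℕP.m+n∸m≡n M _)

  times-neg1-nil : ∀ c → K < c → times D c (just neg1) ≡ nothing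
  times-neg1-nil (suc c) (s≤s K≤c) with ℕP.m≤n⇒m<n∨m≡n K≤c
  ... | inj₁ K<c rewrite times-neg1-nil c K<c = refl
  ... | inj₂ refl rewrite times-neg1 K (s≤s z≤n) ℕP.≤-refl | M∸K =
    ⊕-undefined neg1 (K + K) (undefined-high _ _ (high-true neg1 K+K≤neg1 ℕP.≤-refl) (high-true (K + K) ℕP.≤-refl K+K<M)
                                (trans (cong₂ (λ a b → a + b ≤ᵇ K) M∸neg1 M∸[K+K]) (≤ᵇ-false (ℕP.n≮n K))) (low-false neg1 K<neg1))

  times-neg1-inv : ∀ c v → times D c (just neg1) ≡ just v → (c ≡ 0 × v ≡ 0) ⊎ (0 < c × c ≤ K × v ≡ M ∸ c)
  times-neg1-inv zero v refl = inj₁ (refl , refl)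
  times-neg1-inv (suc c) v eq with suc c Nat.≤? K
  ... | yes c+1≤K = inj₂ (s≤s z≤n , c+1≤K , just-injective (trans (sym eq) (times-neg1 (suc c) (s≤s z≤n) c+1≤K)))
  ... | no c+1≰K with () ← trans (sym (times-neg1-nil (suc c) (ℕP.≰⇒> c+1≰K))) eq

  times-neg1-< : ∀ c v → times D c (just neg1) ≡ just v → v < M
  times-neg1-< c v eq with times-neg1-inv c v eq
  ... | inj₁ (_ , refl) = ℕP.<-trans (s≤s z≤n) K<M
  ... | inj₂ (0<c , _ , refl) = M∸<M c 0<c

  Mid : ℕ → Set
  Mid v = K < v × v < K + K

  Mid⇒<M : ∀ {v} → Mid v → v < M
  Mid⇒<M (_ , v<K+K) = ℕP.<-trans v<K+K K+K<M

  mid⊕-undefined : ∀ {v} w → Mid (suc v) → just (suc v) ⊕ just (suc w) ≡ nothing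
  mid⊕-undefined {v} w (K<v , v<K+K) = ⊕-undefined (suc v) (suc w) (undefined-mid v w (low-false _ K<v) (high-false _ v<K+K))

  times-mid-1 : ∀ v → Mid v → times D 1 (just v) ≡ just v
  times-mid-1 v mid = ⊕-identityʳ v (Mid⇒<M mid)

  times-mid-nil : ∀ v → Mid v → ∀ c → times D (suc (suc c)) (just v) ≡ nothing
  times-mid-nil (suc v) mid zero = trans (cong (just (suc v) ⊕_) (times-mid-1 (suc v) mid)) (mid⊕-undefined v mid)
  times-mid-nil v mid (suc c) = cong (just v ⊕_) (times-mid-nil v mid c)

  times-neg1-zero : ∀ c → times D c (just neg1) ≡ just 0 → c ≡ 0
  times-neg1-zero c eq with times-neg1-inv c 0 eq
  ... | inj₁ (c≡0 , _) = c≡0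
  ... | inj₂ (_ , c≤K , 0≡M∸c) = ⊥-elim (ℕP.<⇒≢ (ℕP.m<n⇒0<n∸m (ℕP.≤-<-trans c≤K K<M)) 0≡M∸c)

  times-neg1-⊕0 : ∀ c → times D c (just neg1) ⊕ just 0 ≡ times D c (just neg1)
  times-neg1-⊕0 c with times D c (just neg1) in eq
  ... | nothing = refl
  ... | just v = ⊕-identityʳ v (times-neg1-< c v eq)

  0⊕times-neg1 : ∀ c → just 0 ⊕ times D c (just neg1) ≡ times D c (just neg1)
  0⊕times-neg1 c with times D c (just neg1) in eq
  ... | nothing = refl
  ... | just v = ⊕-identityˡ v (times-neg1-< c v eq)

  Bounded : Elt → Set
  Bounded y = ∀ w → y ≡ just w → w < M

  0⊕-inv : ∀ y q → Bounded y → just 0 ⊕ y ≡ just q → y ≡ just q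
  0⊕-inv (just v) q bounded eq = trans (sym (⊕-identityˡ v (bounded v refl))) eq

  mid⊕-inv : ∀ v y q → Mid v → just v ⊕ y ≡ just q → y ≡ just 0 × q ≡ v
  mid⊕-inv v (just zero) q mid eq = refl , just-injective (trans (sym eq) (⊕-identityʳ v (Mid⇒<M mid)))
  mid⊕-inv (suc v) (just (suc w)) q mid eq with () ← trans (sym (mid⊕-undefined w mid)) eq

  low⊕-inv : ∀ a y q → suc a ≤ K → (∀ w → y ≡ just (suc w) → K < suc w) → just (suc a) ⊕ y ≡ just q →
             y ≡ just 0 × q ≡ suc a
  low⊕-inv a (just zero) q a<K _ eq = refl , just-injective (trans (sym eq) (⊕-identityʳ (suc a) (ℕP.≤-<-trans a<K K<M)))
  low⊕-inv a (just (suc w)) q a<K big eq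
    with () ← trans (sym (⊕-undefined (suc a) (suc w) (undefined-low-big a w (high-false (suc a) (ℕP.≤-<-trans a<K K<K+K))
                                                                          (low-false (suc w) (big w refl))))) eq

  -- The value of a tail g 0 · P 0 ⊕ … ⊕ g r · P r of the factorization, where P 0, …, P (r - 1) are
  -- middle atoms and P r = neg1: a multiple of neg1, or a single middle atom.
  TailShape : ℕ → (ℕ → ℕ) → (ℕ → ℕ) → ℕ → Set
  TailShape r P g q =
      ((∀ j → j < r → g j ≡ 0) × times D (g r) (just neg1) ≡ just q)
    ⊎ (Σ ℕ λ i → i < r × g i ≡ 1 × (∀ j → j ≤ r → j ≢ i → g j ≡ 0) × q ≡ P i)

  tail-shape : ∀ r (P g : ℕ → ℕ) → (∀ j → j < r → Mid (P j)) → P r ≡ neg1 → ∀ q →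
               evalFold D (suc r) (P ∘ toℕ) (vec (suc r) g) ≡ just q → q < M × TailShape r P g q
  tail-shape zero P g _ Pr≡neg1 q eq = times-neg1-< (g 0) q times≡q , inj₁ ((λ _ ()) , times≡q)
    where
    times≡q : times D (g 0) (just neg1) ≡ just q
    times≡q = trans (sym (times-neg1-⊕0 (g 0))) (subst (λ v → times D (g 0) (just v) ⊕ just 0 ≡ just q) Pr≡neg1 eq)
  tail-shape (suc r) P g mid Pr≡neg1 q eq = head (g 0) refl eq
    where
    rest : Elt
    rest = evalFold D (suc r) (P ∘ suc ∘ toℕ) (vec (suc r) (g ∘ suc))
    IH : ∀ q → rest ≡ just q → q < M × TailShape r (P ∘ suc) (g ∘ suc) q
    IH = tail-shape r (P ∘ suc) (g ∘ suc) (λ j j<r → mid (suc j) (s≤s j<r)) Pr≡neg1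
    mid₀ : Mid (P 0)
    mid₀ = mid 0 (s≤s z≤n)
    head : ∀ c → g 0 ≡ c → times D c (just (P 0)) ⊕ rest ≡ just q → q < M × TailShape (suc r) P g q
    head zero g₀≡0 eq with IH q (0⊕-inv rest q (λ v eq → proj₁ (IH v eq)) eq)
    ... | q<M , inj₁ (zeros , times≡q) = q<M , inj₁ ((λ { zero _ → g₀≡0 ; (suc j) (s≤s j<r) → zeros j j<r }) , times≡q)
    ... | q<M , inj₂ (i , i<r , gi≡1 , zeros , q≡P) =
      q<M , inj₂ (suc i , s≤s i<r , gi≡1 , (λ { zero _ _ → g₀≡0 ; (suc j) (s≤s j≤r) j≢i → zeros j j≤r (j≢i ∘ cong suc) }) , q≡P)
    head (suc zero) g₀≡1 eq with mid⊕-inv (P 0) rest q mid₀ (trans (cong (_⊕ rest) (sym (times-mid-1 (P 0) mid₀))) eq)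
    ... | rest≡0 , q≡P₀ with IH 0 rest≡0
    ... | _ , inj₁ (zeros , times≡0) = subst (_< M) (sym q≡P₀) (Mid⇒<M mid₀) , inj₂ (0 , s≤s z≤n , g₀≡1 , zeros′ , q≡P₀)
      where
      zeros′ : ∀ j → j ≤ suc r → j ≢ 0 → g j ≡ 0
      zeros′ zero _ j≢0 = ⊥-elim (j≢0 refl)
      zeros′ (suc j) (s≤s j≤r) _ with ℕP.m≤n⇒m<n∨m≡n j≤r
      ... | inj₁ j<r = zeros j j<r
      ... | inj₂ refl = times-neg1-zero (g (suc r)) times≡0
    ... | _ , inj₂ (i , i<r , _ , _ , 0≡P) = ⊥-elim (ℕP.<⇒≢ (ℕP.<-trans (s≤s z≤n) (proj₁ (mid (suc i) (s≤s i<r)))) 0≡P)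
    head (suc (suc c)) _ eq with () ← trans (cong (_⊕ rest) (sym (times-mid-nil (P 0) mid₀ c))) eq

  atomℕ : ℕ → ℕ
  atomℕ zero = 1
  atomℕ (suc j) = if suc j ≡ᵇ K then neg1 else D + j

  atom≡atomℕ : ∀ i → atom D i ≡ atomℕ (toℕ i)
  atom≡atomℕ i with toℕ i
  ... | zero = refl
  ... | suc j = refl

  atomℕ-mid : ∀ j → j < suc k → atomℕ (suc j) ≡ D + j
  atomℕ-mid j j<k+1 rewrite ≡ᵇ-false {j} {suc k} (ℕP.<⇒≢ j<k+1) = refl

  atomℕ-last : atomℕ K ≡ neg1
  atomℕ-last rewrite ≡ᵇ-true {k} refl = refl

  D+j<K+K : ∀ j → j < suc k → D + j < K + K
  D+j<K+K j j<k+1 = subst (_≤ K + K) (e K j) (ℕP.+-monoʳ-≤ K (s≤s j<k+1))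
    where
    e : ∀ a b → a + suc (suc b) ≡ suc (suc (a + b))
    e = solveℕ-∀

  Mid-atom : ∀ j → j < suc k → Mid (atomℕ (suc j))
  Mid-atom j j<k+1 rewrite atomℕ-mid j j<k+1 = s≤s (ℕP.m≤m+n K j) , D+j<K+K j j<k+1

  -- The three kinds of non-nil elements: multiples of the atom 1, single middle atoms, multiples of neg1.
  Shape : (ℕ → ℕ) → ℕ → Set
  Shape f q =
      (f 0 ≡ q × q ≤ K × (∀ j → 0 < j → j ≤ K → f j ≡ 0))
    ⊎ (f 0 ≡ 0 × (∀ j → 0 < j → j < K → f j ≡ 0) × 0 < f K × f K ≤ K × q ≡ M ∸ f K)
    ⊎ (Σ ℕ λ i → i < suc k × f 0 ≡ 0 × f (suc i) ≡ 1 × (∀ j → j ≤ K → j ≢ suc i → f j ≡ 0) × q ≡ D + i)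

  eval-shape : ∀ f q → eval D (vec D f) ≡ just q → q < M × Shape f q
  eval-shape f q eq = head (f 0) refl eq
    where
    rest : Elt
    rest = evalFold D K (atomℕ ∘ suc ∘ toℕ) (vec K (f ∘ suc))
    IH : ∀ q → rest ≡ just q → q < M × TailShape (suc k) (atomℕ ∘ suc) (f ∘ suc) q
    IH = tail-shape (suc k) (atomℕ ∘ suc) (f ∘ suc) Mid-atom atomℕ-last
    rest-big : ∀ w → rest ≡ just (suc w) → K < suc w
    rest-big w eq with IH (suc w) eq
    ... | _ , inj₁ (_ , times≡) with times-neg1-inv (f K) (suc w) times≡
    ...   | inj₁ (_ , ())
    ...   | inj₂ (_ , fK≤K , w≡) = subst (K <_) (sym w≡) (ℕP.<-≤-trans K<K+K (subst (_≤ M ∸ f K) M∸K (ℕP.∸-monoʳ-≤ M fK≤K)))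
    rest-big w eq | _ , inj₂ (i , i<k+1 , _ , _ , w≡) = subst (K <_) (sym (trans w≡ (atomℕ-mid i i<k+1))) (s≤s (ℕP.m≤m+n K i))
    head : ∀ c → f 0 ≡ c → times D c (just 1) ⊕ rest ≡ just q → q < M × Shape f q
    head zero f₀≡0 eq with IH q (0⊕-inv rest q (λ v eq → proj₁ (IH v eq)) eq)
    ... | q<M , inj₁ (zeros , times≡q) with times-neg1-inv (f K) q times≡q
    ...   | inj₁ (fK≡0 , refl) = q<M , inj₁ (f₀≡0 , z≤n , zeros′)
      where
      zeros′ : ∀ j → 0 < j → j ≤ K → f j ≡ 0
      zeros′ (suc j) _ (s≤s j≤k+1) with ℕP.m≤n⇒m<n∨m≡n j≤k+1
      ... | inj₁ j<k+1 = zeros j j<k+1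
      ... | inj₂ refl = fK≡0
    ...   | inj₂ (0<fK , fK≤K , q≡) = q<M , inj₂ (inj₁ (f₀≡0 , (λ { (suc j) _ (s≤s j<k+1) → zeros j j<k+1 }) , 0<fK , fK≤K , q≡))
    head zero f₀≡0 eq | q<M , inj₂ (i , i<k+1 , fi≡1 , zeros , q≡) =
      q<M , inj₂ (inj₂ (i , i<k+1 , f₀≡0 , fi≡1 , (λ { zero _ _ → f₀≡0 ; (suc j) (s≤s j≤k+1) j≢i → zeros j j≤k+1 (j≢i ∘ cong suc) })
                       , trans q≡ (atomℕ-mid i i<k+1)))
    head (suc a) f₀≡ eq with suc a Nat.≤? K
    ... | no a+1≰K with () ← trans (cong (_⊕ rest) (sym (times-1-nil (suc a) (ℕP.≰⇒> a+1≰K)))) eq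
    ... | yes a+1≤K with low⊕-inv a rest q a+1≤K rest-big (trans (cong (_⊕ rest) (sym (times-1 (suc a) a+1≤K))) eq)
    ...   | rest≡0 , refl with IH 0 rest≡0
    ...     | _ , inj₁ (zeros , times≡0) = ℕP.≤-<-trans a+1≤K K<M , inj₁ (f₀≡ , a+1≤K , zeros′)
      where
      zeros′ : ∀ j → 0 < j → j ≤ K → f j ≡ 0
      zeros′ (suc j) _ (s≤s j≤k+1) with ℕP.m≤n⇒m<n∨m≡n j≤k+1
      ... | inj₁ j<k+1 = zeros j j<k+1
      ... | inj₂ refl = times-neg1-zero (f K) times≡0
    ...     | _ , inj₂ (i , i<k+1 , _ , _ , 0≡) = ⊥-elim (ℕP.<⇒≢ (ℕP.<-trans (s≤s z≤n) (proj₁ (Mid-atom i i<k+1))) 0≡)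

  -- Z_N(q) = {Φ q} for every residue q < M.
  Φ : ℕ → ℕ → ℕ
  Φ q = if q ≤ᵇ K then q ·e 0 else if q <ᵇ K + K then 1 ·e (q ∸ K) else (M ∸ q) ·e K

  Φ-low : ∀ {q} → q ≤ K → Φ q ≡ q ·e 0
  Φ-low q≤K rewrite ≤ᵇ-true q≤K = refl

  Φ-mid : ∀ {q} → K < q → q < K + K → Φ q ≡ 1 ·e (q ∸ K)
  Φ-mid K<q q<K+K rewrite ≤ᵇ-false (ℕP.<⇒≱ K<q) | <ᵇ-true q<K+K = refl

  Φ-high : ∀ {q} → K + K ≤ q → Φ q ≡ (M ∸ q) ·e K
  Φ-high K+K≤q rewrite ≤ᵇ-false (ℕP.<⇒≱ (ℕP.<-≤-trans K<K+K K+K≤q)) | <ᵇ-false (ℕP.≤⇒≯ K+K≤q) = refl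

  Φ-atom : ∀ r → r < D → Φ (atomℕ r) ≡ 1 ·e r
  Φ-atom zero _ = Φ-low (s≤s z≤n)
  Φ-atom (suc j) (s≤s j+1≤K) with ℕP.m≤n⇒m<n∨m≡n j+1≤K
  ... | inj₁ (s≤s j<k+1) rewrite atomℕ-mid j j<k+1 =
    trans (Φ-mid (s≤s (ℕP.m≤m+n K j)) (D+j<K+K j j<k+1)) (cong (1 ·e_) (trans (cong (_∸ K) (sym (ℕP.+-suc K j))) (ℕP.m+n∸m≡n K (suc j))))
  ... | inj₂ refl rewrite atomℕ-last = trans (Φ-high K+K≤neg1) (cong (_·e K) M∸neg1)

  eval-inv : ∀ f q → eval D (vec D f) ≡ just q → q < M × (∀ j → j < D → f j ≡ Φ q j)
  eval-inv f q eq with eval-shape f q eq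
  ... | q<M , inj₁ (f₀≡q , q≤K , zeros) = q<M , f≗Φq
    where
    f≗Φq : ∀ j → j < D → f j ≡ Φ q j
    f≗Φq zero _ rewrite Φ-low q≤K = f₀≡q
    f≗Φq (suc j) (s≤s j≤K) rewrite Φ-low q≤K = zeros (suc j) (s≤s z≤n) j≤K
  ... | q<M , inj₂ (inj₁ (f₀≡0 , zeros , 0<fK , fK≤K , q≡M∸fK)) = q<M , f≗Φq
    where
    K+K≤q : K + K ≤ q
    K+K≤q = subst (K + K ≤_) (sym q≡M∸fK) (subst (_≤ M ∸ f K) M∸K (ℕP.∸-monoʳ-≤ M fK≤K))
    M∸q : M ∸ q ≡ f K
    M∸q = trans (cong (M ∸_) q≡M∸fK) (ℕP.m∸[m∸n]≡n (ℕP.<⇒≤ (ℕP.≤-<-trans fK≤K K<M)))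
    f≗Φq : ∀ j → j < D → f j ≡ Φ q j
    f≗Φq j j<D rewrite Φ-high K+K≤q | M∸q with j Nat.≟ K
    ... | yes refl = sym (·e-at (f K) K)
    ... | no j≢K = trans (zero-off-K j j<D j≢K) (sym (·e-off (f K) K j≢K))
      where
      zero-off-K : ∀ j → j < D → j ≢ K → f j ≡ 0
      zero-off-K zero _ _ = f₀≡0
      zero-off-K (suc j) (s≤s j+1≤K) j≢K with ℕP.m≤n⇒m<n∨m≡n j+1≤K
      ... | inj₁ j+1<K = zeros (suc j) (s≤s z≤n) j+1<K
      ... | inj₂ refl = ⊥-elim (j≢K refl)
  ... | q<M , inj₂ (inj₂ (i , i<k+1 , f₀≡0 , fi≡1 , zeros , refl)) = q<M , f≗Φq
    where
    D+i∸K : D + i ∸ K ≡ suc i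
    D+i∸K = trans (cong (_∸ K) (sym (ℕP.+-suc K i))) (ℕP.m+n∸m≡n K (suc i))
    f≗Φq : ∀ j → j < D → f j ≡ Φ (D + i) j
    f≗Φq j j<D rewrite Φ-mid (s≤s (ℕP.m≤m+n K i)) (D+j<K+K i i<k+1) | D+i∸K with j Nat.≟ suc i
    ... | yes refl = trans fi≡1 (sym (·e-at 1 (suc i)))
    ... | no j≢i = trans (zeros j (ℕP.≤-pred j<D) j≢i) (sym (·e-off 1 (suc i) j≢i))

  factorization-unique : ∀ z q → eval D z ≡ just q → q < M × z ≡ vec D (Φ q)
  factorization-unique z q eq = q<M , trans (vec-lookupOr 0 z) (vec-cong D z≗Φq)
    where
    inv = eval-inv (lookupOr 0 z) q (subst (λ w → eval D w ≡ just q) (vec-lookupOr 0 z) eq)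
    q<M = proj₁ inv
    z≗Φq = proj₂ inv

  tail-eval-neg1 : ∀ r (P g : ℕ → ℕ) → P r ≡ neg1 → (∀ j → j < r → g j ≡ 0) →
                   evalFold D (suc r) (P ∘ toℕ) (vec (suc r) g) ≡ times D (g r) (just neg1)
  tail-eval-neg1 zero P g Pr≡neg1 _ = trans (cong (λ v → times D (g 0) (just v) ⊕ just 0) Pr≡neg1) (times-neg1-⊕0 (g 0))
  tail-eval-neg1 (suc r) P g Pr≡neg1 zeros =
    trans (cong₂ _⊕_ (cong (λ c → times D c (just (P 0))) (zeros 0 (s≤s z≤n)))
                     (tail-eval-neg1 r (P ∘ suc) (g ∘ suc) Pr≡neg1 (λ j j<r → zeros (suc j) (s≤s j<r))))
          (0⊕times-neg1 (g (suc r)))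

  tail-eval-mid : ∀ r (P g : ℕ → ℕ) i → (∀ j → j < r → Mid (P j)) → P r ≡ neg1 → i < r → g i ≡ 1 →
                  (∀ j → j ≤ r → j ≢ i → g j ≡ 0) → evalFold D (suc r) (P ∘ toℕ) (vec (suc r) g) ≡ just (P i)
  tail-eval-mid (suc r) P g zero mid Pr≡neg1 _ g₀≡1 zeros =
    trans (cong₂ _⊕_ (trans (cong (λ c → times D c (just (P 0))) g₀≡1) (times-mid-1 (P 0) (mid 0 (s≤s z≤n))))
                     (trans (tail-eval-neg1 r (P ∘ suc) (g ∘ suc) Pr≡neg1 (λ j j<r → zeros (suc j) (s≤s (ℕP.<⇒≤ j<r)) (λ ())))
                            (cong (λ c → times D c (just neg1)) (zeros (suc r) ℕP.≤-refl (λ ())))))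
          (⊕-identityʳ (P 0) (Mid⇒<M (mid 0 (s≤s z≤n))))
  tail-eval-mid (suc r) P g (suc i) mid Pr≡neg1 (s≤s i<r) gi≡1 zeros =
    trans (cong₂ _⊕_ (cong (λ c → times D c (just (P 0))) (zeros 0 z≤n (λ ())))
                     (tail-eval-mid r (P ∘ suc) (g ∘ suc) i (λ j j<r → mid (suc j) (s≤s j<r)) Pr≡neg1 i<r gi≡1
                        (λ j j≤r j≢i → zeros (suc j) (s≤s j≤r) (j≢i ∘ ℕP.suc-injective))))
          (⊕-identityˡ (P (suc i)) (Mid⇒<M (mid (suc i) (s≤s i<r))))

  eval-low : ∀ c → c ≤ K → eval D (vec D (c ·e 0)) ≡ just c
  eval-low c c≤K = trans (cong₂ _⊕_ (times-1 c c≤K) (tail-eval-neg1 (suc k) (atomℕ ∘ suc) _ atomℕ-last (λ _ _ → refl)))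
                         (⊕-identityʳ c (ℕP.≤-<-trans c≤K K<M))

  eval-high : ∀ c → 0 < c → c ≤ K → eval D (vec D (c ·e K)) ≡ just (M ∸ c)
  eval-high c 0<c c≤K =
    trans (cong (just 0 ⊕_) (trans (tail-eval-neg1 (suc k) (atomℕ ∘ suc) _ atomℕ-last
                                     (λ j j<k+1 → ·e-off c K (ℕP.<⇒≢ j<k+1 ∘ ℕP.suc-injective)))
                                   (trans (cong (λ c → times D c (just neg1)) (·e-at c K)) (times-neg1 c 0<c c≤K))))
          (⊕-identityˡ (M ∸ c) (M∸<M c 0<c))

  eval-mid : ∀ i → i < suc k → eval D (vec D (1 ·e suc i)) ≡ just (D + i)
  eval-mid i i<k+1 =
    trans (cong (just 0 ⊕_) (trans (tail-eval-mid (suc k) (atomℕ ∘ suc) _ i Mid-atom atomℕ-last i<k+1 (·e-at 1 (suc i))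
                                      (λ j _ j≢i → ·e-off 1 (suc i) (j≢i ∘ ℕP.suc-injective)))
                                   (cong just (atomℕ-mid i i<k+1))))
          (⊕-identityˡ (D + i) (ℕP.<-trans (D+j<K+K i i<k+1) K+K<M))

  eval-Φ : ∀ q → q < M → eval D (vec D (Φ q)) ≡ just q
  eval-Φ q q<M with q Nat.≤? K
  ... | yes q≤K rewrite Φ-low q≤K = eval-low q q≤K
  ... | no q≰K with q Nat.<? K + K
  ...   | yes q<K+K = trans (cong (eval D ∘ vec D) (trans (Φ-mid (ℕP.≰⇒> q≰K) q<K+K) (cong (1 ·e_) q∸K≡)))
                            (trans (eval-mid i i<k+1) (cong just (ℕP.m+[n∸m]≡n D≤q)))
    where
    D≤q = ℕP.≰⇒> q≰K
    i = q ∸ D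
    q∸K≡ : q ∸ K ≡ suc i
    q∸K≡ = ℕP.+-∸-assoc 1 D≤q
    i<k+1 : i < suc k
    i<k+1 = ℕP.+-cancelˡ-< D i (suc k) (subst₂ _<_ (sym (ℕP.m+[n∸m]≡n D≤q)) (e k) q<K+K)
      where
      e : ∀ k → (2 + k) + (2 + k) ≡ (3 + k) + suc k
      e = solveℕ-∀
  ...   | no q≮K+K rewrite Φ-high (ℕP.≮⇒≥ q≮K+K) =
    trans (eval-high (M ∸ q) (ℕP.m<n⇒0<n∸m q<M) (subst (M ∸ q ≤_) M∸[K+K] (ℕP.∸-monoʳ-≤ M (ℕP.≮⇒≥ q≮K+K))))
          (cong just (ℕP.m∸[m∸n]≡n (ℕP.<⇒≤ q<M)))

  atomℕ<M : ∀ r → r < D → atomℕ r < M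
  atomℕ<M zero _ = ℕP.<-trans (s≤s (s≤s z≤n)) K<M
  atomℕ<M (suc j) (s≤s j+1≤K) with ℕP.m≤n⇒m<n∨m≡n j+1≤K
  ... | inj₁ (s≤s j<k+1) rewrite atomℕ-mid j j<k+1 = ℕP.<-trans (D+j<K+K j j<k+1) K+K<M
  ... | inj₂ refl rewrite atomℕ-last = ℕP.≤-refl

  eval-unit : ∀ r → r < D → eval D (vec D (1 ·e r)) ≡ just (atomℕ r)
  eval-unit r r<D = subst (λ f → eval D (vec D f) ≡ just (atomℕ r)) (Φ-atom r r<D) (eval-Φ (atomℕ r) (atomℕ<M r r<D))

  Φ-scaled-unit : ∀ q → q < M → Σ ℕ λ c → Σ ℕ λ a → c ≤ K × Φ q ≡ c ·e a
  Φ-scaled-unit q q<M with q Nat.≤? K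
  ... | yes q≤K = q , 0 , q≤K , Φ-low q≤K
  ... | no q≰K with q Nat.<? K + K
  ...   | yes q<K+K = 1 , q ∸ K , s≤s z≤n , Φ-mid (ℕP.≰⇒> q≰K) q<K+K
  ...   | no q≮K+K = M ∸ q , K , subst (M ∸ q ≤_) M∸[K+K] (ℕP.∸-monoʳ-≤ M (ℕP.≮⇒≥ q≮K+K)) , Φ-high (ℕP.≮⇒≥ q≮K+K)

  nil-of-large-entry : ∀ f j → j < D → K < f j → eval D (vec D f) ≡ nothing
  nil-of-large-entry f j j<D K<fj with eval D (vec D f) in eq
  ... | nothing = refl
  ... | just q with eval-inv f q eq
  ...   | q<M , f≗Φq with Φ-scaled-unit q q<M
  ...     | c , a , c≤K , Φq≡ = ⊥-elim (ℕP.<⇒≱ K<fj fj≤K)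
    where
    fj≤K : f j ≤ K
    fj≤K = ℕP.≤-trans (ℕP.≤-reflexive (trans (f≗Φq j j<D) (cong (_$ j) Φq≡))) (ℕP.≤-trans (·e-≤ c a j) c≤K)

  nil-of-two-entries : ∀ f a b → a < D → b < D → a ≢ b → 0 < f a → 0 < f b → eval D (vec D f) ≡ nothing
  nil-of-two-entries f a b a<D b<D a≢b 0<fa 0<fb with eval D (vec D f) in eq
  ... | nothing = refl
  ... | just q with eval-inv f q eq
  ...   | q<M , f≗Φq with Φ-scaled-unit q q<M
  ...     | c , e , _ , Φq≡ = ⊥-elim (a≢b (trans (support a a<D 0<fa) (sym (support b b<D 0<fb))))
    where
    support : ∀ j → j < D → 0 < f j → j ≡ e
    support j j<D 0<fj = ·e-support c e j (subst (0 <_) (trans (f≗Φq j j<D) (cong (_$ j) Φq≡)) 0<fj)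

  singleton-outerBetti : ∀ z → eval D z ≡ nothing →
                         (∀ i → 0 < lookup z i → Σ ℕ λ q → eval D (updateAt z i Nat.pred) ≡ just q) →
                         OuterBetti D [ z ]
  singleton-outerBetti z z-nil below-non-nil = record { nil = nil ; cond-i = cond-i ; cond-ii = cond-ii }
    where
    nil : ∀ z′ → z′ ∈ [ z ] → eval D z′ ≡ nothing
    nil z′ (here refl) = z-nil
    cond-i : ∀ i → InSupp [ z ] i → Σ ℕ λ q → q < M × (∀ w → (w ∈ [ z ] -e i → eval D w ≡ just q) × (eval D w ≡ just q → w ∈ [ z ] -e i))
    cond-i i (_ , here refl , 0<zi) = q , proj₁ (factorization-unique (updateAt z i Nat.pred) q eq) , λ w → to w , from w
      where
      q = proj₁ (below-non-nil i 0<zi)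
      eq = proj₂ (below-non-nil i 0<zi)
      restore : updateAt (updateAt z i Nat.pred) i suc ≡ z
      restore = trans (VecP.updateAt-updateAt i z) (VecP.updateAt-id-local i z (ℕP.suc-pred (lookup z i) {{Nat.>-nonZero 0<zi}}))
      to : ∀ w → w ∈ [ z ] -e i → eval D w ≡ just q
      to w (here w+eᵢ≡z) = subst (λ v → eval D v ≡ just q) (sym w≡) eq
        where
        w≡ : w ≡ updateAt z i Nat.pred
        w≡ = trans (sym (trans (VecP.updateAt-updateAt i w) (VecP.updateAt-id i w))) (cong (λ v → updateAt v i Nat.pred) w+eᵢ≡z)
      from : ∀ w → eval D w ≡ just q → w ∈ [ z ] -e i
      from w eq′ = here (trans (cong (λ v → updateAt v i suc) w≡) restore)
        where
        w≡ : w ≡ updateAt z i Nat.pred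
        w≡ = trans (proj₂ (factorization-unique w q eq′)) (sym (proj₂ (factorization-unique (updateAt z i Nat.pred) q eq)))
    cond-ii : ∀ z₁ z₂ → z₁ ∈ [ z ] → z₂ ∈ [ z ] → Star (Adj [ z ]) z₁ z₂
    cond-ii _ _ (here refl) (here refl) = ε

  pair : ℕ → ℕ → Fact D
  pair a b = vec D (λ j → (1 ·e a) j + (1 ·e b) j)

  power : ℕ → Fact D
  power a = vec D (D ·e a)

  pair-support : ∀ a b j → 0 < (1 ·e a) j + (1 ·e b) j → j ≡ a ⊎ j ≡ b
  pair-support a b j pos with j ≡ᵇ a in eqa
  ... | true = inj₁ (ℕP.≡ᵇ⇒≡ j a (subst T (sym eqa) _))
  ... | false with j ≡ᵇ b in eqb
  ...   | true = inj₂ (ℕP.≡ᵇ⇒≡ j b (subst T (sym eqb) _))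
  ...   | false = ⊥-elim (ℕP.<-irrefl refl pos)

  pair-outerBetti : ∀ a b → a < D → b < D → a ≢ b → OuterBetti D [ pair a b ]
  pair-outerBetti a b a<D b<D a≢b = singleton-outerBetti (pair a b) pair-nil below
    where
    pair-nil : eval D (pair a b) ≡ nothing
    pair-nil = nil-of-two-entries (λ j → (1 ·e a) j + (1 ·e b) j) a b a<D b<D a≢b (subst (λ n → 0 < n + (1 ·e b) a) (sym (·e-at 1 a)) (s≤s z≤n))
                                                     (subst (λ n → 0 < (1 ·e a) b + n) (sym (·e-at 1 b)) (ℕP.m≤n+m 1 _))
    below : ∀ i → 0 < lookup (pair a b) i → Σ ℕ λ q → eval D (updateAt (pair a b) i Nat.pred) ≡ just q
    below i pos with pair-support a b (toℕ i) (subst (0 <_) (lookup-vec (λ j → (1 ·e a) j + (1 ·e b) j) i) pos)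
    ... | inj₁ refl = atomℕ b ,
      trans (cong (eval D) (trans (updateAt-vec (λ j → (1 ·e a) j + (1 ·e b) j) i Nat.pred) (vec-cong D leaves-b)))
            (eval-unit b b<D)
      where
      leaves-b : ∀ j → j < D → (if j ≡ᵇ toℕ i then Nat.pred ((1 ·e toℕ i) j + (1 ·e b) j) else (1 ·e toℕ i) j + (1 ·e b) j) ≡ (1 ·e b) j
      leaves-b j _ with j Nat.≟ toℕ i
      ... | yes refl rewrite ≡ᵇ-true {j} refl | ·e-off 1 b a≢b = refl
      ... | no j≢i rewrite ≡ᵇ-false j≢i = refl
    ... | inj₂ refl = atomℕ a ,
      trans (cong (eval D) (trans (updateAt-vec (λ j → (1 ·e a) j + (1 ·e b) j) i Nat.pred) (vec-cong D leaves-a)))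
            (eval-unit a a<D)
      where
      leaves-a : ∀ j → j < D → (if j ≡ᵇ toℕ i then Nat.pred ((1 ·e a) j + (1 ·e toℕ i) j) else (1 ·e a) j + (1 ·e toℕ i) j) ≡ (1 ·e a) j
      leaves-a j _ with j Nat.≟ toℕ i
      ... | yes refl rewrite ≡ᵇ-true {j} refl | ·e-off 1 a (a≢b ∘ sym) = ℕP.+-identityʳ 0
      ... | no j≢i rewrite ≡ᵇ-false j≢i = ℕP.+-identityʳ _

  power-outerBetti : ∀ a → a < D → (Σ ℕ λ q → eval D (vec D (K ·e a)) ≡ just q) → OuterBetti D [ power a ]
  power-outerBetti a a<D (q , Ka-non-nil) = singleton-outerBetti (power a) power-nil below
    where
    power-nil : eval D (power a) ≡ nothing
    power-nil = nil-of-large-entry (D ·e a) a a<D (subst (K <_) (sym (·e-at D a)) ℕP.≤-refl)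
    below : ∀ i → 0 < lookup (power a) i → Σ ℕ λ q → eval D (updateAt (power a) i Nat.pred) ≡ just q
    below i pos with ·e-support D a (toℕ i) (subst (0 <_) (lookup-vec (D ·e a) i) pos)
    ... | refl = q , trans (cong (eval D) (trans (updateAt-vec (D ·e a) i Nat.pred) (vec-cong D leaves-K))) Ka-non-nil
      where
      leaves-K : ∀ j → j < D → (if j ≡ᵇ toℕ i then Nat.pred ((D ·e toℕ i) j) else (D ·e toℕ i) j) ≡ (K ·e toℕ i) j
      leaves-K j _ with j Nat.≟ toℕ i
      ... | yes refl rewrite ≡ᵇ-true {j} refl = refl
      ... | no j≢i rewrite ≡ᵇ-false j≢i = refl

  atoms≡ : tabulate (atom D) ≡ vec D atomℕ
  atoms≡ = tabulate-vec (atom D) atomℕ atom≡atomℕ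

  zbar-pair : ∀ a b → a < D → b < D → zbar D (pair a b) ≡ (atomℕ a + atomℕ b) % M
  zbar-pair a b a<D b<D = cong (_% M) (begin
    dotℕ (pair a b) (tabulate (atom D))                          ≡⟨ cong (dotℕ (pair a b)) atoms≡ ⟩
    dotℕ (pair a b) (vec D atomℕ)                                ≡⟨ dotℕ-+ D (1 ·e a) (1 ·e b) (vec D atomℕ) ⟩
    dotℕ (vec D (1 ·e a)) (vec D atomℕ) + dotℕ (vec D (1 ·e b)) (vec D atomℕ)
                                                                 ≡⟨ cong₂ _+_ (unit a a<D) (unit b b<D) ⟩
    atomℕ a + atomℕ b                                           ∎)
    where
    open ≡-Reasoning
    unit : ∀ r → r < D → dotℕ (vec D (1 ·e r)) (vec D atomℕ) ≡ atomℕ r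
    unit r r<D = trans (dotℕ-·e D 1 r (vec D atomℕ) r<D) (trans (ℕP.*-identityˡ _) (lookupOr-vec 0 atomℕ r<D))

  zbar-power : ∀ a → a < D → zbar D (power a) ≡ (D * atomℕ a) % M
  zbar-power a a<D = cong (_% M) (trans (cong (dotℕ (power a)) atoms≡)
                                        (trans (dotℕ-·e D D a (vec D atomℕ) a<D) (cong (D *_) (lookupOr-vec 0 atomℕ a<D))))

  factorizations-agree : ∀ x → InH D x
  factorizations-agree x q _ c c′ eq eq′ =
    cong (λ v → dot v x) (trans (proj₂ (factorization-unique c q eq)) (sym (proj₂ (factorization-unique c′ q eq′))))

  data Region : ℕ → Set where
    in-low  : ∀ {q} → q < K → Region q
    in-mid  : ∀ {j} → j < K → Region (K + j)
    in-high : ∀ c {h} → suc c + h ≡ K → Region (K + K + h)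

  region : ∀ q → q < M → Region q
  region q q<M with q Nat.<? K
  ... | yes q<K = in-low q<K
  ... | no q≮K with q ∸ K Nat.<? K
  ...   | yes j<K = subst Region (ℕP.m+[n∸m]≡n (ℕP.≮⇒≥ q≮K)) (in-mid j<K)
  ...   | no j≮K = subst Region (ℕP.m+[n∸m]≡n K+K≤q) (in-high (K ∸ suc h) (trans (sym (ℕP.+-suc (K ∸ suc h) h)) (ℕP.m∸n+n≡m h<K)))
    where
    K+K≤q : K + K ≤ q
    K+K≤q = subst (K + K ≤_) (ℕP.m+[n∸m]≡n (ℕP.≮⇒≥ q≮K)) (ℕP.+-monoʳ-≤ K (ℕP.≮⇒≥ j≮K))
    h = q ∸ (K + K)
    h<K : h < K
    h<K = ℕP.+-cancelˡ-< (K + K) h K (subst₂ _<_ (sym (ℕP.m+[n∸m]≡n K+K≤q)) M≡K+K+K q<M)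

module Values (k : ℕ) (x : Vec ℚ (suc (suc (suc k)))) where
  open import Data.Rational using (_+_; _*_; _-_; -_)
  open CupSemigroup k
  open ℚP.≤-Reasoning

  s t : ℚ
  s = coord x 0
  t = coord x K

  ψ : ℕ → ℚ
  ψ q = dot (vec D (Φ (q % M))) x

  ψ-cong : ∀ a b → a % M ≡ b % M → ψ a ≡ ψ b
  ψ-cong _ _ = cong (λ r → dot (vec D (Φ r)) x)

  ψ-mod : ∀ q → ψ (q % M) ≡ ψ q
  ψ-mod q = ψ-cong (q % M) q (ℕD.m%n%n≡m%n q M)

  ψ-+-mod : ∀ a b → ψ (a % M +ℕ b % M) ≡ ψ (a +ℕ b)
  ψ-+-mod a b = ψ-cong (a % M +ℕ b % M) (a +ℕ b) (sym (ℕD.%-distribˡ-+ a b M))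

  ψ-+*M : ∀ q c → ψ (q +ℕ c *ℕ M) ≡ ψ q
  ψ-+*M q c = ψ-cong (q +ℕ c *ℕ M) q (ℕD.[m+kn]%n≡m%n q c M)

  ψ-+M : ∀ q → ψ (q +ℕ M) ≡ ψ q
  ψ-+M q = ψ-cong (q +ℕ M) q (ℕD.[m+n]%n≡m%n q M)

  ψ-< : ∀ {q} → q < M → ψ q ≡ dot (vec D (Φ q)) x
  ψ-< q<M = cong (λ r → dot (vec D (Φ r)) x) (ℕD.m<n⇒m%n≡m q<M)

  ψ-low : ∀ {q} → q ≤ K → ψ q ≡ toℚ q * s
  ψ-low {q} q≤K = trans (ψ-< (ℕP.≤-<-trans q≤K K<M)) (trans (cong (λ f → dot (vec D f) x) (Φ-low q≤K)) (dot-·e D q 0 x (s≤s z≤n)))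

  ψ-zero : ψ 0 ≡ 0ℚ
  ψ-zero = trans (ψ-low z≤n) (ℚP.*-zeroˡ s)

  ψ-high : ∀ c h → c +ℕ h ≡ K → ψ (K +ℕ K +ℕ h) ≡ toℚ c * t
  ψ-high zero h refl = trans (trans (cong ψ (sym M≡K+K+K)) (trans (ψ-+M 0) ψ-zero)) (sym (ℚP.*-zeroˡ t))
  ψ-high (suc c) h c+h≡K =
    trans (ψ-< q<M) (trans (cong (λ f → dot (vec D f) x) (trans (Φ-high (ℕP.m≤m+n (K +ℕ K) h)) (cong (_·e K) M∸q≡c)))
                            (dot-·e D (suc c) K x ℕP.≤-refl))
    where
    M≡q+c : M ≡ K +ℕ K +ℕ h +ℕ suc c
    M≡q+c = trans M≡K+K+K (trans (cong (K +ℕ K +ℕ_) (trans (sym c+h≡K) (ℕP.+-comm (suc c) h))) (sym (ℕP.+-assoc (K +ℕ K) h (suc c))))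
    q<M : K +ℕ K +ℕ h < M
    q<M = subst (K +ℕ K +ℕ h <_) (sym M≡q+c) (ℕP.m<m+n _ (s≤s z≤n))
    M∸q≡c : M ∸ℕ (K +ℕ K +ℕ h) ≡ suc c
    M∸q≡c = trans (cong (_∸ℕ (K +ℕ K +ℕ h)) M≡q+c) (ℕP.m+n∸m≡n (K +ℕ K +ℕ h) (suc c))

  ψ-atom : ∀ r → r < D → ψ (atomℕ r) ≡ coord x r
  ψ-atom r r<D = trans (ψ-< (atomℕ<M r r<D)) (trans (cong (λ f → dot (vec D f) x) (Φ-atom r r<D))
                        (trans (dot-·e D 1 r x r<D) (ℚP.*-identityˡ (coord x r))))

  ψ-mid : ∀ r → r < suc k → ψ (K +ℕ suc r) ≡ coord x (suc r)
  ψ-mid r r<k+1 = trans (cong ψ (trans (ℕP.+-suc K r) (sym (atomℕ-mid r r<k+1)))) (ψ-atom (suc r) (s≤s (s≤s (ℕP.<⇒≤ r<k+1))))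

  dot-pair : ∀ a b → a < D → b < D → dot (pair a b) x ≡ coord x a + coord x b
  dot-pair a b a<D b<D = trans (dot-+ D (1 ·e a) (1 ·e b) x)
    (cong₂ _+_ (trans (dot-·e D 1 a x a<D) (ℚP.*-identityˡ (coord x a))) (trans (dot-·e D 1 b x b<D) (ℚP.*-identityˡ (coord x b))))

  MidSteps : Set
  MidSteps = ∀ r → r < K → ψ (K +ℕ suc r) ≤ℚ ψ (K +ℕ r) + s × ψ (K +ℕ r) ≤ℚ ψ (K +ℕ suc r) + t

  module _ (steps : MidSteps) where

    s+t-nonNeg : 0ℚ ≤ℚ s + t
    s+t-nonNeg = +-cancelˡ-≤ (ψ (K +ℕ 1) + ψ (K +ℕ 0)) (begin
      ψ (K +ℕ 1) + ψ (K +ℕ 0) + 0ℚ        ≡⟨ ℚP.+-identityʳ _ ⟩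
      ψ (K +ℕ 1) + ψ (K +ℕ 0)             ≤⟨ ℚP.+-mono-≤ (proj₁ (steps 0 0<K)) (proj₂ (steps 0 0<K)) ⟩
      (ψ (K +ℕ 0) + s) + (ψ (K +ℕ 1) + t) ≡⟨ e (ψ (K +ℕ 0)) (ψ (K +ℕ 1)) s t ⟩
      ψ (K +ℕ 1) + ψ (K +ℕ 0) + (s + t) ∎)
      where
      0<K = s≤s z≤n
      e : ∀ a b s t → (a + s) + (b + t) ≡ b + a + (s + t)
      e = solve-∀ ℚ-ring

    private
      low-ψ-suc : ∀ {q} → q < K → ψ (suc q) ≡ ψ q + s
      low-ψ-suc {q} q<K = trans (ψ-low q<K) (trans (cong (_* s) (toℚ-suc q))
                                 (trans (e (toℚ q) s) (cong (_+ s) (sym (ψ-low (ℕP.<⇒≤ q<K))))))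
        where
        e : ∀ a s → (1ℚ + a) * s ≡ a * s + s
        e = solve-∀ ℚ-ring

      high-ψ : ∀ c {h} → suc c +ℕ h ≡ K → ψ (K +ℕ K +ℕ h) ≡ ψ (suc (K +ℕ K +ℕ h)) + t
      high-ψ c {h} c+1+h≡K =
        trans (ψ-high (suc c) h c+1+h≡K) (trans (cong (_* t) (toℚ-suc c))
          (trans (e (toℚ c) t) (cong (_+ t) (sym (trans (cong ψ (sym (ℕP.+-suc (K +ℕ K) h)))
                                                         (ψ-high c (suc h) (trans (ℕP.+-suc c h) c+1+h≡K)))))))
        where
        e : ∀ c t → (1ℚ + c) * t ≡ c * t + t
        e = solve-∀ ℚ-ring

      ≤-+-s+t : ∀ a → a ≤ℚ a + (s + t)
      ≤-+-s+t a = ≤-by-slack (s + t) s+t-nonNeg refl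

    step-s< : ∀ q → q < M → ψ (suc q) ≤ℚ ψ q + s
    step-s< q q<M with region q q<M
    ... | in-low q<K = ℚP.≤-reflexive (low-ψ-suc q<K)
    ... | in-mid {j} j<K = subst (λ n → ψ n ≤ℚ ψ (K +ℕ j) + s) (ℕP.+-suc K j) (proj₁ (steps j j<K))
    ... | in-high c {h} eq = begin
      ψ (suc (K +ℕ K +ℕ h))                 ≤⟨ ≤-+-s+t _ ⟩
      ψ (suc (K +ℕ K +ℕ h)) + (s + t)       ≡⟨ e (ψ (suc (K +ℕ K +ℕ h))) s t ⟩
      ψ (suc (K +ℕ K +ℕ h)) + t + s         ≡⟨ cong (_+ s) (sym (high-ψ c eq)) ⟩
      ψ (K +ℕ K +ℕ h) + s                   ∎
      where
      e : ∀ a s t → a + (s + t) ≡ a + t + s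
      e = solve-∀ ℚ-ring

    step-t< : ∀ q → q < M → ψ q ≤ℚ ψ (suc q) + t
    step-t< q q<M with region q q<M
    ... | in-low q<K = begin
      ψ q                 ≤⟨ ≤-+-s+t _ ⟩
      ψ q + (s + t)       ≡⟨ sym (ℚP.+-assoc (ψ q) s t) ⟩
      ψ q + s + t         ≡⟨ cong (_+ t) (sym (low-ψ-suc q<K)) ⟩
      ψ (suc q) + t       ∎
    ... | in-mid {j} j<K = subst (λ n → ψ (K +ℕ j) ≤ℚ ψ n + t) (ℕP.+-suc K j) (proj₂ (steps j j<K))
    ... | in-high c eq = ℚP.≤-reflexive (high-ψ c eq)

    ψ-suc-mod : ∀ q → ψ (suc (q % M)) ≡ ψ (suc q)
    ψ-suc-mod q = trans (cong ψ (ℕP.+-comm 1 (q % M))) (trans (ψ-+-mod q 1) (cong ψ (ℕP.+-comm q 1)))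

    step-s : ∀ q → ψ (suc q) ≤ℚ ψ q + s
    step-s q = subst₂ (λ a b → a ≤ℚ b + s) (ψ-suc-mod q) (ψ-mod q) (step-s< (q % M) (ℕD.m%n<n q M))

    step-t : ∀ q → ψ q ≤ℚ ψ (suc q) + t
    step-t q = subst₂ (λ a b → a ≤ℚ b + t) (ψ-mod q) (ψ-suc-mod q) (step-t< (q % M) (ℕD.m%n<n q M))

    ψ-forward : ∀ q n → ψ (q +ℕ n) ≤ℚ ψ q + toℚ n * s
    ψ-forward q zero = ℚP.≤-reflexive (trans (cong ψ (ℕP.+-identityʳ q)) (sym (trans (cong (ψ q +_) (ℚP.*-zeroˡ s)) (ℚP.+-identityʳ (ψ q)))))
    ψ-forward q (suc n) = begin
      ψ (q +ℕ suc n)            ≡⟨ cong ψ (ℕP.+-suc q n) ⟩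
      ψ (suc (q +ℕ n))          ≤⟨ step-s (q +ℕ n) ⟩
      ψ (q +ℕ n) + s            ≤⟨ ℚP.+-monoˡ-≤ s (ψ-forward q n) ⟩
      ψ q + toℚ n * s + s       ≡⟨ e (ψ q) (toℚ n) s ⟩
      ψ q + (1ℚ + toℚ n) * s    ≡⟨ cong (λ c → ψ q + c * s) (sym (toℚ-suc n)) ⟩
      ψ q + toℚ (suc n) * s     ∎
      where
      e : ∀ a n s → a + n * s + s ≡ a + (1ℚ + n) * s
      e = solve-∀ ℚ-ring

    ψ-backward : ∀ q n → ψ q ≤ℚ ψ (q +ℕ n) + toℚ n * t
    ψ-backward q zero = ℚP.≤-reflexive (sym (trans (cong₂ _+_ (cong ψ (ℕP.+-identityʳ q)) (ℚP.*-zeroˡ t)) (ℚP.+-identityʳ (ψ q))))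
    ψ-backward q (suc n) = begin
      ψ q                                   ≤⟨ ψ-backward q n ⟩
      ψ (q +ℕ n) + toℚ n * t                ≤⟨ ℚP.+-monoˡ-≤ (toℚ n * t) (step-t (q +ℕ n)) ⟩
      ψ (suc (q +ℕ n)) + t + toℚ n * t      ≡⟨ e (ψ (suc (q +ℕ n))) (toℚ n) t ⟩
      ψ (suc (q +ℕ n)) + (1ℚ + toℚ n) * t   ≡⟨ cong₂ (λ a c → ψ a + c * t) (sym (ℕP.+-suc q n)) (sym (toℚ-suc n)) ⟩
      ψ (q +ℕ suc n) + toℚ (suc n) * t      ∎
      where
      e : ∀ a n t → a + t + n * t ≡ a + (1ℚ + n) * t
      e = solve-∀ ℚ-ring

    subadditive-low : ∀ {a} b → a < K → ψ (a +ℕ b) ≤ℚ ψ a + ψ b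
    subadditive-low {a} b a<K = begin
      ψ (a +ℕ b)          ≡⟨ cong ψ (ℕP.+-comm a b) ⟩
      ψ (b +ℕ a)          ≤⟨ ψ-forward b a ⟩
      ψ b + toℚ a * s     ≡⟨ ℚP.+-comm (ψ b) _ ⟩
      toℚ a * s + ψ b     ≡⟨ cong (_+ ψ b) (sym (ψ-low (ℕP.<⇒≤ a<K))) ⟩
      ψ a + ψ b           ∎

    subadditive-high : ∀ c {h} b → suc c +ℕ h ≡ K → ψ (K +ℕ K +ℕ h +ℕ b) ≤ℚ ψ (K +ℕ K +ℕ h) + ψ b
    subadditive-high c {h} b c+1+h≡K = begin
      ψ (K +ℕ K +ℕ h +ℕ b)                            ≤⟨ ψ-backward (K +ℕ K +ℕ h +ℕ b) (suc c) ⟩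
      ψ (K +ℕ K +ℕ h +ℕ b +ℕ suc c) + toℚ (suc c) * t ≡⟨ cong₂ _+_ (trans (cong ψ wraps) (ψ-+M b)) (sym (ψ-high (suc c) h c+1+h≡K)) ⟩
      ψ b + ψ (K +ℕ K +ℕ h)                           ≡⟨ ℚP.+-comm (ψ b) _ ⟩
      ψ (K +ℕ K +ℕ h) + ψ b                           ∎
      where
      wraps : K +ℕ K +ℕ h +ℕ b +ℕ suc c ≡ b +ℕ M
      wraps = trans (e K h b (suc c)) (trans (cong (λ n → b +ℕ (K +ℕ K +ℕ n)) (trans (ℕP.+-comm h (suc c)) c+1+h≡K))
                                             (cong (b +ℕ_) (sym M≡K+K+K)))
        where
        e : ∀ K h b c → K +ℕ K +ℕ h +ℕ b +ℕ c ≡ b +ℕ (K +ℕ K +ℕ (h +ℕ c))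
        e = solveℕ-∀

    -- Both middle values are bounded below by walking to the corners K (value K s) and K + K (value K t).
    subadditive-mid : ∀ {i j} → i < K → j < K → ψ (K +ℕ j +ℕ (K +ℕ i)) ≤ℚ ψ (K +ℕ j) + ψ (K +ℕ i)
    subadditive-mid {i} {j} i<K j<K = +-cancelˡ-≤ (toℚ i * t + toℚ cⱼ * s) (begin
      toℚ i * t + toℚ cⱼ * s + ψ (K +ℕ j +ℕ (K +ℕ i)) ≤⟨ ℚP.+-monoʳ-≤ (toℚ i * t + toℚ cⱼ * s) upper ⟩
      toℚ i * t + toℚ cⱼ * s + (toℚ cᵢ * t + toℚ j * s) ≡⟨ e₁ (toℚ i) (toℚ cᵢ) (toℚ j) (toℚ cⱼ) s t ⟩
      (toℚ cⱼ + toℚ j) * s + (toℚ cᵢ + toℚ i) * t      ≡⟨ cong₂ (λ a b → a * s + b * t) (trans (sym (toℚ-+ cⱼ j)) (cong toℚ cⱼ+j≡K))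
                                                                                     (trans (sym (toℚ-+ cᵢ i)) (cong toℚ cᵢ+i≡K)) ⟩
      toℚ K * s + toℚ K * t                            ≤⟨ ℚP.+-mono-≤ lower-i lower-j ⟩
      (ψ (K +ℕ i) + toℚ i * t) + (ψ (K +ℕ j) + toℚ cⱼ * s) ≡⟨ e₂ (ψ (K +ℕ i)) (ψ (K +ℕ j)) (toℚ i * t) (toℚ cⱼ * s) ⟩
      toℚ i * t + toℚ cⱼ * s + (ψ (K +ℕ j) + ψ (K +ℕ i)) ∎)
      where
      cᵢ = K ∸ℕ i
      cⱼ = K ∸ℕ j
      cᵢ+i≡K = ℕP.m∸n+n≡m (ℕP.<⇒≤ i<K)
      cⱼ+j≡K = ℕP.m∸n+n≡m (ℕP.<⇒≤ j<K)
      lower-i : toℚ K * s ≤ℚ ψ (K +ℕ i) + toℚ i * t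
      lower-i = subst (_≤ℚ ψ (K +ℕ i) + toℚ i * t) (ψ-low ℕP.≤-refl) (ψ-backward K i)
      lower-j : toℚ K * t ≤ℚ ψ (K +ℕ j) + toℚ cⱼ * s
      lower-j = subst (_≤ℚ ψ (K +ℕ j) + toℚ cⱼ * s) (trans (cong ψ to-2K) (ψ-high K 0 (ℕP.+-identityʳ K))) (ψ-forward (K +ℕ j) cⱼ)
        where
        to-2K : K +ℕ j +ℕ cⱼ ≡ K +ℕ K +ℕ 0
        to-2K = trans (ℕP.+-assoc K j cⱼ) (trans (cong (K +ℕ_) (trans (ℕP.+-comm j cⱼ) cⱼ+j≡K)) (sym (ℕP.+-identityʳ (K +ℕ K))))
      upper : ψ (K +ℕ j +ℕ (K +ℕ i)) ≤ℚ toℚ cᵢ * t + toℚ j * s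
      upper = begin
        ψ (K +ℕ j +ℕ (K +ℕ i))      ≡⟨ cong ψ (e K i j) ⟩
        ψ (K +ℕ K +ℕ i +ℕ j)        ≤⟨ ψ-forward (K +ℕ K +ℕ i) j ⟩
        ψ (K +ℕ K +ℕ i) + toℚ j * s ≡⟨ cong (_+ toℚ j * s) (ψ-high cᵢ i cᵢ+i≡K) ⟩
        toℚ cᵢ * t + toℚ j * s      ∎
        where
        e : ∀ K i j → K +ℕ j +ℕ (K +ℕ i) ≡ K +ℕ K +ℕ i +ℕ j
        e = solveℕ-∀
      e₁ : ∀ i cᵢ j cⱼ s t → i * t + cⱼ * s + (cᵢ * t + j * s) ≡ (cⱼ + j) * s + (cᵢ + i) * t
      e₁ = solve-∀ ℚ-ring
      e₂ : ∀ a b u v → (a + u) + (b + v) ≡ u + v + (b + a)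
      e₂ = solve-∀ ℚ-ring

    private
      swap : ∀ a b → ψ (b +ℕ a) ≤ℚ ψ b + ψ a → ψ (a +ℕ b) ≤ℚ ψ a + ψ b
      swap a b = subst₂ _≤ℚ_ (cong ψ (ℕP.+-comm b a)) (ℚP.+-comm (ψ b) (ψ a))

    subadditive< : ∀ a b → a < M → b < M → ψ (a +ℕ b) ≤ℚ ψ a + ψ b
    subadditive< a b a<M b<M with region a a<M
    ... | in-low a<K = subadditive-low b a<K
    ... | in-high c eq = subadditive-high c b eq
    ... | in-mid {j} j<K with region b b<M
    ...   | in-low b<K = swap (K +ℕ j) b (subadditive-low (K +ℕ j) b<K)
    ...   | in-high c eq = swap (K +ℕ j) b (subadditive-high c (K +ℕ j) eq)
    ...   | in-mid i<K = subadditive-mid i<K j<K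

    subadditive : ∀ a b → ψ (a +ℕ b) ≤ℚ ψ a + ψ b
    subadditive a b = subst₂ _≤ℚ_ (ψ-+-mod a b) (cong₂ _+_ (ψ-mod a) (ψ-mod b))
                             (subadditive< (a % M) (b % M) (ℕD.m%n<n a M) (ℕD.m%n<n b M))

    map-ψ-atoms : map ψ (tabulate (atom D)) ≡ x
    map-ψ-atoms = trans (cong (map ψ) atoms≡)
                 (trans (map-vec D ψ atomℕ) (trans (vec-cong D ψ-atom) (sym (vec-lookupOr 0ℚ x))))

    betti-inequality : ∀ z a → eval D a ≡ just (zbar D z) → dot a x ≤ℚ dot z x
    betti-inequality z a eq = begin
      dot a x                               ≡⟨ cong (λ v → dot v x) a≡Φ ⟩
      dot (vec D (Φ (zbar D z))) x          ≡⟨ sym (ψ-< (ℕD.m%n<n (dotℕ z (tabulate (atom D))) M)) ⟩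
      ψ (zbar D z)                          ≡⟨ ψ-mod (dotℕ z (tabulate (atom D))) ⟩
      ψ (dotℕ z (tabulate (atom D)))        ≤⟨ subadditive-dot ψ subadditive (ℚP.≤-reflexive ψ-zero) z (tabulate (atom D)) ⟩
      dot z (map ψ (tabulate (atom D)))     ≡⟨ cong (dot z) map-ψ-atoms ⟩
      dot z x                               ∎
      where
      a≡Φ = proj₂ (factorization-unique a (zbar D z) eq)

    MidSteps⇒InF : InF D x
    MidSteps⇒InF = factorizations-agree x , λ _ _ z _ → betti-inequality z

  module _ (inF : InF D x) where

    betti-singleton : ∀ z → OuterBetti D [ z ] → ψ (zbar D z) ≤ℚ dot z x
    betti-singleton z ob =
      subst (_≤ℚ dot z x) (sym (ψ-< zbar<M)) (proj₂ inF [ z ] ob z (here refl) (vec D (Φ (zbar D z))) (eval-Φ (zbar D z) zbar<M))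
      where
      zbar<M = ℕD.m%n<n (dotℕ z (tabulate (atom D))) M

    pair-inequality : ∀ a b → a < D → b < D → a ≢ b → ψ (atomℕ a +ℕ atomℕ b) ≤ℚ coord x a + coord x b
    pair-inequality a b a<D b<D a≢b =
      subst₂ _≤ℚ_ (trans (cong ψ (zbar-pair a b a<D b<D)) (ψ-mod (atomℕ a +ℕ atomℕ b))) (dot-pair a b a<D b<D)
             (betti-singleton (pair a b) (pair-outerBetti a b a<D b<D a≢b))

    power-inequality : ∀ a → a < D → (Σ ℕ λ q → eval D (vec D (K ·e a)) ≡ just q) → ψ (D *ℕ atomℕ a) ≤ℚ toℚ D * coord x a
    power-inequality a a<D non-nil =
      subst₂ _≤ℚ_ (trans (cong ψ (zbar-power a a<D)) (ψ-mod (D *ℕ atomℕ a))) (dot-·e D D a x a<D)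
             (betti-singleton (power a) (power-outerBetti a a<D non-nil))

    private
      toℚD* : ∀ a → toℚ D * a ≡ toℚ K * a + a
      toℚD* a = trans (cong (_* a) (toℚ-suc K)) (e (toℚ K) a)
        where
        e : ∀ c a → (1ℚ + c) * a ≡ c * a + a
        e = solve-∀ ℚ-ring

    InF⇒MidSteps : MidSteps
    InF⇒MidSteps r r<K = s-step r r<K , t-step r r<K
      where
      s-step : ∀ r → r < K → ψ (K +ℕ suc r) ≤ℚ ψ (K +ℕ r) + s
      s-step zero _ = subst₂ _≤ℚ_ (cong ψ (trans (ℕP.*-identityʳ D) (ℕP.+-comm 1 K)))
                                  (trans (toℚD* s) (cong (_+ s) (sym (trans (cong ψ (ℕP.+-identityʳ K)) (ψ-low ℕP.≤-refl)))))
                                  (power-inequality 0 (s≤s z≤n) (K , eval-low K ℕP.≤-refl))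
      s-step (suc r) (s≤s r<k+1) =
        subst₂ _≤ℚ_ (cong ψ (trans (cong suc atom≡) (sym (ℕP.+-suc K (suc r)))))
                    (trans (ℚP.+-comm s _) (cong (_+ s) (sym (ψ-mid r r<k+1))))
                    (pair-inequality 0 (suc r) (s≤s z≤n) (s≤s (ℕP.<⇒≤ (s≤s r<k+1))) (λ ()))
        where
        atom≡ : atomℕ (suc r) ≡ K +ℕ suc r
        atom≡ = trans (atomℕ-mid r r<k+1) (sym (ℕP.+-suc K r))
      t-step : ∀ r → r < K → ψ (K +ℕ r) ≤ℚ ψ (K +ℕ suc r) + t
      t-step r r<K with suc r Nat.<? K
      ... | yes (s≤s r+1≤k+1) =
        subst₂ _≤ℚ_ (trans (cong ψ (trans (cong (_+ℕ atomℕ (suc r)) atomℕ-last) (trans (cong (neg1 +ℕ_) atom≡) (e k r)))) (ψ-+M (K +ℕ r)))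
                    (trans (ℚP.+-comm t _) (cong (_+ t) (sym (ψ-mid r r+1≤k+1))))
                    (pair-inequality K (suc r) ℕP.≤-refl (s≤s (ℕP.<⇒≤ (s≤s r+1≤k+1))) (ℕP.<⇒≢ (s≤s r+1≤k+1) ∘ sym))
        where
        atom≡ : atomℕ (suc r) ≡ K +ℕ suc r
        atom≡ = trans (atomℕ-mid r r+1≤k+1) (sym (ℕP.+-suc K r))
        e : ∀ k r → suc (k +ℕ ((2 +ℕ k) +ℕ ((2 +ℕ k) +ℕ 0))) +ℕ ((2 +ℕ k) +ℕ suc r) ≡ (2 +ℕ k) +ℕ r +ℕ ((2 +ℕ k) +ℕ ((2 +ℕ k) +ℕ ((2 +ℕ k) +ℕ 0)))
        e = solveℕ-∀
      ... | no r+1≮K with ℕP.suc-injective (ℕP.≤-antisym r<K (ℕP.≮⇒≥ r+1≮K))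
      ... | refl = subst₂ _≤ℚ_ (trans (cong ψ (trans (cong (D *ℕ_) atomℕ-last) (e k))) (ψ-+*M (K +ℕ suc k) K))
                               (trans (toℚD* t) (cong (_+ t) (sym ψ[K+K])))
                               (power-inequality K ℕP.≤-refl (M ∸ℕ K , eval-high K (s≤s z≤n) ℕP.≤-refl))
        where
        ψ[K+K] : ψ (K +ℕ K) ≡ toℚ K * t
        ψ[K+K] = trans (cong ψ (sym (ℕP.+-identityʳ (K +ℕ K)))) (ψ-high K 0 (ℕP.+-identityʳ K))
        e : ∀ k → (3 +ℕ k) *ℕ suc (k +ℕ ((2 +ℕ k) +ℕ ((2 +ℕ k) +ℕ 0)))
                ≡ (2 +ℕ k) +ℕ suc k +ℕ (2 +ℕ k) *ℕ ((2 +ℕ k) +ℕ ((2 +ℕ k) +ℕ ((2 +ℕ k) +ℕ 0)))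
        e = solveℕ-∀

module CubeCoordinates (k : ℕ) where
  open import Data.Rational using (_+_; _*_; _-_; -_)
  open CupSemigroup k using (K; D; M; Φ)
  open Values k

  coordinate-cases : ∀ j → j < D → j ≡ 0 ⊎ (0 < j × j < K) ⊎ j ≡ K
  coordinate-cases zero _ = inj₁ refl
  coordinate-cases (suc j) (s≤s j<K) with ℕP.m≤n⇒m<n∨m≡n j<K
  ... | inj₁ j+1<K = inj₂ (inj₁ (s≤s z≤n , j+1<K))
  ... | inj₂ j+1≡K = inj₂ (inj₂ j+1≡K)

  δ : ℕ → ℕ → ℚ
  δ a = toℚ ∘ (1 ·e a)

  dotℚ-δ : ∀ a (x : Vec ℚ D) → a < D → dotℚ (vec D (δ a)) x ≡ coord x a
  dotℚ-δ a x a<D = trans (dotℚ-toℚ D (1 ·e a) x) (trans (dot-·e D 1 a x a<D) (ℚP.*-identityˡ (coord x a)))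

  ψ-row : ℕ → ℕ → ℚ
  ψ-row q = toℚ ∘ Φ (q % M)

  cubeRow : ℕ → ℕ → ℚ
  cubeRow r = if r <ᵇ K then (λ j → δ 0 j + ψ-row (K +ℕ r) j - ψ-row (K +ℕ suc r) j) else (λ j → δ 0 j + δ K j)

  -- Opaque, so that goals about apply cubeMatrix x are not normalised entry by entry.
  opaque
    cubeMatrix : Matrix D
    cubeMatrix = matrix D cubeRow

    coord-cube : ∀ x r → r < D → coord (apply cubeMatrix x) r ≡ dotℚ (vec D (cubeRow r)) x
    coord-cube = coord-apply-matrix D cubeRow

  cubeRow-< : ∀ {r} → r < K → cubeRow r ≡ λ j → δ 0 j + ψ-row (K +ℕ r) j - ψ-row (K +ℕ suc r) j
  cubeRow-< r<K = if-true (<ᵇ-true r<K)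

  cubeRow-K : cubeRow K ≡ λ j → δ 0 j + δ K j
  cubeRow-K = if-false (<ᵇ-false (ℕP.n≮n K))

  cube-coord : ∀ x r → r < K → coord (apply cubeMatrix x) r ≡ s x + ψ x (K +ℕ r) - ψ x (K +ℕ suc r)
  cube-coord x r r<K =
    trans (coord-cube x r (ℕP.m<n⇒m<1+n r<K))
    (trans (cong (λ f → dotℚ (vec D f) x) (cubeRow-< r<K))
    (trans (dotℚ-diff D (λ j → δ 0 j + ψ-row (K +ℕ r) j) (ψ-row (K +ℕ suc r)) x)
           (cong₂ _-_ (trans (dotℚ-+ D (δ 0) (ψ-row (K +ℕ r)) x)
                             (cong₂ _+_ (dotℚ-δ 0 x (s≤s z≤n)) (dotℚ-toℚ D (Φ ((K +ℕ r) % M)) x)))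
                      (dotℚ-toℚ D (Φ ((K +ℕ suc r) % M)) x))))

  cube-coord-K : ∀ x → coord (apply cubeMatrix x) K ≡ s x + t x
  cube-coord-K x =
    trans (coord-cube x K (ℕP.n<1+n K))
    (trans (cong (λ f → dotℚ (vec D f) x) cubeRow-K)
    (trans (dotℚ-+ D (δ 0) (δ K) x) (cong₂ _+_ (dotℚ-δ 0 x (s≤s z≤n)) (dotℚ-δ K x (ℕP.n<1+n K)))))

  κ : ℚ
  κ = toℚ K

  -- 3K as a normalised rational, so that 1/_ applies
  κ₃ : ℚ
  κ₃ = mkℚ (ℤ.+ (K +ℕ K +ℕ K)) 0 (coprime-sym (1-coprimeTo _))

  κ+κ+κ≡κ₃ : κ + κ + κ ≡ κ₃
  κ+κ+κ≡κ₃ = trans (sym (trans (toℚ-+ (K +ℕ K) K) (cong (_+ κ) (toℚ-+ K K)))) (toℚ≡mkℚ (K +ℕ K +ℕ K))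

  -- Σ_{r<K} y_r telescopes to 2Ks - Kt and y_K = s + t, so s = (Σ_{r<K} y_r + K y_K) / 3K.
  σ : Vec ℚ D → ℚ
  σ y = 1/ κ₃ * (partialSum y K + κ * coord y K)

  σ-row : ℕ → ℚ
  σ-row j = 1/ κ₃ * (toℚ (prefix K j) + κ * δ K j)

  inverseRow : ℕ → ℕ → ℚ
  inverseRow r = if r ≡ᵇ 0 then σ-row
                 else if r ≡ᵇ K then (λ j → δ K j - σ-row j)
                 else (λ j → toℚ (K +ℕ r) * σ-row j - toℚ (prefix r j))

  opaque
    inverseMatrix : Matrix D
    inverseMatrix = matrix D inverseRow

    coord-inverse : ∀ y r → r < D → coord (apply inverseMatrix y) r ≡ dotℚ (vec D (inverseRow r)) y
    coord-inverse = coord-apply-matrix D inverseRow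

  dotℚ-σ-row : ∀ y → dotℚ (vec D σ-row) y ≡ σ y
  dotℚ-σ-row y =
    trans (dotℚ-* D (1/ κ₃) (λ j → toℚ (prefix K j) + κ * δ K j) y)
          (cong (1/ κ₃ *_) (trans (dotℚ-+ D (toℚ ∘ prefix K) (λ j → κ * δ K j) y)
                                  (cong₂ _+_ (trans (dotℚ-toℚ D (prefix K) y) (dot-prefix D K y (ℕP.n≤1+n K)))
                                             (trans (dotℚ-* D κ (δ K) y) (cong (κ *_) (dotℚ-δ K y (ℕP.n<1+n K)))))))

  inverse-coord-0 : ∀ y → coord (apply inverseMatrix y) 0 ≡ σ y
  inverse-coord-0 y = trans (coord-inverse y 0 (s≤s z≤n)) (dotℚ-σ-row y)

  inverse-coord-K : ∀ y → coord (apply inverseMatrix y) K ≡ coord y K - σ y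
  inverse-coord-K y =
    trans (coord-inverse y K (ℕP.n<1+n K))
    (trans (cong (λ f → dotℚ (vec D f) y) (if-true (≡ᵇ-true {k} refl)))
    (trans (dotℚ-diff D (δ K) σ-row y) (cong₂ _-_ (dotℚ-δ K y (ℕP.n<1+n K)) (dotℚ-σ-row y))))

  inverse-coord-mid : ∀ y r → 0 < r → r < K → coord (apply inverseMatrix y) r ≡ toℚ (K +ℕ r) * σ y - partialSum y r
  inverse-coord-mid y (suc r) _ r+1<K =
    trans (coord-inverse y (suc r) (ℕP.m<n⇒m<1+n r+1<K))
    (trans (cong (λ f → dotℚ (vec D f) y) (if-false (≡ᵇ-false (ℕP.<⇒≢ r+1<K))))
    (trans (dotℚ-diff D (λ j → toℚ (K +ℕ suc r) * σ-row j) (toℚ ∘ prefix (suc r)) y)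
           (cong₂ _-_ (trans (dotℚ-* D (toℚ (K +ℕ suc r)) σ-row y) (cong (toℚ (K +ℕ suc r) *_) (dotℚ-σ-row y)))
                      (trans (dotℚ-toℚ D (prefix (suc r)) y) (dot-prefix D (suc r) y (ℕP.<⇒≤ (ℕP.m<n⇒m<1+n r+1<K)))))))

  private
    κ₃-cancelˡ : ∀ a → 1/ κ₃ * ((κ + κ + κ) * a) ≡ a
    κ₃-cancelˡ a = begin
      1/ κ₃ * ((κ + κ + κ) * a)  ≡⟨ cong (λ c → 1/ κ₃ * (c * a)) κ+κ+κ≡κ₃ ⟩
      1/ κ₃ * (κ₃ * a)           ≡⟨ sym (ℚP.*-assoc (1/ κ₃) κ₃ a) ⟩
      1/ κ₃ * κ₃ * a             ≡⟨ cong (_* a) (ℚP.*-inverseˡ κ₃) ⟩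
      1ℚ * a                     ≡⟨ ℚP.*-identityˡ a ⟩
      a                          ∎
      where open ≡-Reasoning

    κ₃-cancelʳ : ∀ a → (κ + κ + κ) * (1/ κ₃ * a) ≡ a
    κ₃-cancelʳ a = begin
      (κ + κ + κ) * (1/ κ₃ * a)  ≡⟨ cong (λ c → c * (1/ κ₃ * a)) κ+κ+κ≡κ₃ ⟩
      κ₃ * (1/ κ₃ * a)           ≡⟨ sym (ℚP.*-assoc κ₃ (1/ κ₃) a) ⟩
      κ₃ * 1/ κ₃ * a             ≡⟨ cong (_* a) (ℚP.*-inverseʳ κ₃) ⟩
      1ℚ * a                     ≡⟨ ℚP.*-identityˡ a ⟩
      a                          ∎
      where open ≡-Reasoning

    ψ-K+0 : ∀ x → ψ x (K +ℕ 0) ≡ κ * s x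
    ψ-K+0 x = trans (cong (ψ x) (ℕP.+-identityʳ K)) (ψ-low x ℕP.≤-refl)

    ψ-K+K : ∀ x → ψ x (K +ℕ K) ≡ κ * t x
    ψ-K+K x = trans (cong (ψ x) (sym (ℕP.+-identityʳ (K +ℕ K)))) (ψ-high x K 0 (ℕP.+-identityʳ K))

    toℚ-K+ : ∀ r → toℚ (K +ℕ r) ≡ κ + toℚ r
    toℚ-K+ = toℚ-+ K

  inverse∘cube : ∀ x → apply inverseMatrix (apply cubeMatrix x) ≡ x
  inverse∘cube x = vec-ext D 0ℚ coordinates
    where
    open ≡-Reasoning
    y = apply cubeMatrix x
    partialSum-y : ∀ r → r ≤ K → partialSum y r ≡ toℚ r * s x + ψ x (K +ℕ 0) - ψ x (K +ℕ r)
    partialSum-y r r≤K = telescope y (s x) (λ r → ψ x (K +ℕ r)) r (λ j j<r → cube-coord x j (ℕP.<-≤-trans j<r r≤K))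
    σ-y : σ y ≡ s x
    σ-y = begin
      1/ κ₃ * (partialSum y K + κ * coord y K)                        ≡⟨ cong₂ (λ a b → 1/ κ₃ * (a + κ * b)) (partialSum-y K ℕP.≤-refl) (cube-coord-K x) ⟩
      1/ κ₃ * (κ * s x + ψ x (K +ℕ 0) - ψ x (K +ℕ K) + κ * (s x + t x)) ≡⟨ cong₂ (λ a b → 1/ κ₃ * (κ * s x + a - b + κ * (s x + t x))) (ψ-K+0 x) (ψ-K+K x) ⟩
      1/ κ₃ * (κ * s x + κ * s x - κ * t x + κ * (s x + t x))          ≡⟨ cong (1/ κ₃ *_) (e κ (s x) (t x)) ⟩
      1/ κ₃ * ((κ + κ + κ) * s x)                                     ≡⟨ κ₃-cancelˡ (s x) ⟩
      s x                                                             ∎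
      where
      e : ∀ κ s t → κ * s + κ * s - κ * t + κ * (s + t) ≡ (κ + κ + κ) * s
      e = solve-∀ ℚ-ring
    coordinates : ∀ j → j < D → coord (apply inverseMatrix y) j ≡ coord x j
    coordinates j j<D with coordinate-cases j j<D
    ... | inj₁ refl = trans (inverse-coord-0 y) σ-y
    ... | inj₂ (inj₂ refl) = begin
      coord (apply inverseMatrix y) K  ≡⟨ inverse-coord-K y ⟩
      coord y K - σ y                 ≡⟨ cong₂ _-_ (cube-coord-K x) σ-y ⟩
      s x + t x - s x                 ≡⟨ e (s x) (t x) ⟩
      t x                             ∎
      where
      e : ∀ s t → s + t - s ≡ t
      e = solve-∀ ℚ-ring
    ... | inj₂ (inj₁ (0<j , j<K)) = begin
      coord (apply inverseMatrix y) j                                   ≡⟨ inverse-coord-mid y j 0<j j<K ⟩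
      toℚ (K +ℕ j) * σ y - partialSum y j                               ≡⟨ cong₂ (λ a b → a * σ y - b) (toℚ-K+ j) (partialSum-y j (ℕP.<⇒≤ j<K)) ⟩
      (κ + toℚ j) * σ y - (toℚ j * s x + ψ x (K +ℕ 0) - ψ x (K +ℕ j))    ≡⟨ cong₂ (λ a b → (κ + toℚ j) * a - (toℚ j * s x + b - ψ x (K +ℕ j))) σ-y (ψ-K+0 x) ⟩
      (κ + toℚ j) * s x - (toℚ j * s x + κ * s x - ψ x (K +ℕ j))         ≡⟨ e κ (toℚ j) (s x) (ψ x (K +ℕ j)) ⟩
      ψ x (K +ℕ j)                                                      ≡⟨ ψ-middle j 0<j j<K ⟩
      coord x j                                                         ∎
      where
      e : ∀ κ j s a → (κ + j) * s - (j * s + κ * s - a) ≡ a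
      e = solve-∀ ℚ-ring
      ψ-middle : ∀ j → 0 < j → j < K → ψ x (K +ℕ j) ≡ coord x j
      ψ-middle (suc r) _ (s≤s r<k+1) = ψ-mid x r r<k+1

  cube∘inverse : ∀ y → apply cubeMatrix (apply inverseMatrix y) ≡ y
  cube∘inverse y = vec-ext D 0ℚ coordinates
    where
    open ≡-Reasoning
    x = apply inverseMatrix y
    s-x : s x ≡ σ y
    s-x = inverse-coord-0 y
    partialSum-K : partialSum y K ≡ (κ + κ + κ) * σ y - κ * coord y K
    partialSum-K = trans (e (partialSum y K) (κ * coord y K)) (cong (_- κ * coord y K) (sym (κ₃-cancelʳ (partialSum y K + κ * coord y K))))
      where
      e : ∀ a b → a ≡ a + b - b
      e = solve-∀ ℚ-ring
    ψ-x : ∀ r → r ≤ K → ψ x (K +ℕ r) ≡ toℚ (K +ℕ r) * σ y - partialSum y r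
    ψ-x r r≤K with coordinate-cases r (s≤s r≤K)
    ... | inj₁ refl = begin
      ψ x (K +ℕ 0)                  ≡⟨ trans (ψ-K+0 x) (cong (κ *_) s-x) ⟩
      κ * σ y                       ≡⟨ sym (ℚP.+-identityʳ (κ * σ y)) ⟩
      κ * σ y - 0ℚ                  ≡⟨ cong (λ c → c * σ y - 0ℚ) (sym (cong toℚ (ℕP.+-identityʳ K))) ⟩
      toℚ (K +ℕ 0) * σ y - 0ℚ       ∎
    ... | inj₂ (inj₁ (0<r , r<K)) = trans (ψ-middle r 0<r r<K) (inverse-coord-mid y r 0<r r<K)
      where
      ψ-middle : ∀ j → 0 < j → j < K → ψ x (K +ℕ j) ≡ coord x j
      ψ-middle (suc r) _ (s≤s r<k+1) = ψ-mid x r r<k+1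
    ... | inj₂ (inj₂ refl) = begin
      ψ x (K +ℕ K)                                             ≡⟨ trans (ψ-K+K x) (cong (κ *_) (inverse-coord-K y)) ⟩
      κ * (coord y K - σ y)                                    ≡⟨ e κ (coord y K) (σ y) ⟩
      (κ + κ) * σ y - ((κ + κ + κ) * σ y - κ * coord y K)     ≡⟨ cong₂ (λ a b → a * σ y - b) (sym (toℚ-K+ K)) (sym partialSum-K) ⟩
      toℚ (K +ℕ K) * σ y - partialSum y K                      ∎
      where
      e : ∀ κ a b → κ * (a - b) ≡ (κ + κ) * b - ((κ + κ + κ) * b - κ * a)
      e = solve-∀ ℚ-ring
    coordinates : ∀ r → r < D → coord (apply cubeMatrix x) r ≡ coord y r
    coordinates r (s≤s r≤K) with ℕP.m≤n⇒m<n∨m≡n r≤K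
    ... | inj₁ r<K = begin
      coord (apply cubeMatrix x) r                         ≡⟨ cube-coord x r r<K ⟩
      s x + ψ x (K +ℕ r) - ψ x (K +ℕ suc r)                 ≡⟨ cong₃ s-x (ψ-x r (ℕP.<⇒≤ r<K)) (ψ-x (suc r) r<K) ⟩
      σ y + (toℚ (K +ℕ r) * σ y - partialSum y r)
          - (toℚ (K +ℕ suc r) * σ y - (partialSum y r + coord y r))
                                                           ≡⟨ cong (λ c → σ y + (toℚ (K +ℕ r) * σ y - partialSum y r) - (c * σ y - (partialSum y r + coord y r)))
                                                                   (trans (cong toℚ (ℕP.+-suc K r)) (toℚ-suc (K +ℕ r))) ⟩
      σ y + (toℚ (K +ℕ r) * σ y - partialSum y r)
          - ((1ℚ + toℚ (K +ℕ r)) * σ y - (partialSum y r + coord y r))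
                                                           ≡⟨ e (σ y) (toℚ (K +ℕ r)) (partialSum y r) (coord y r) ⟩
      coord y r                                            ∎
      where
      cong₃ : ∀ {a a′ b b′ c c′} → a ≡ a′ → b ≡ b′ → c ≡ c′ → a + b - c ≡ a′ + b′ - c′
      cong₃ refl refl refl = refl
      e : ∀ σ c p y → σ + (c * σ - p) - ((1ℚ + c) * σ - (p + y)) ≡ y
      e = solve-∀ ℚ-ring
    ... | inj₂ refl = begin
      coord (apply cubeMatrix x) K   ≡⟨ cube-coord-K x ⟩
      s x + t x                      ≡⟨ cong₂ _+_ s-x (inverse-coord-K y) ⟩
      σ y + (coord y K - σ y)        ≡⟨ e (σ y) (coord y K) ⟩
      coord y K                      ∎
      where
      e : ∀ σ a → σ + (a - σ) ≡ a
      e = solve-∀ ℚ-ring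

  MidSteps⇒cube : ∀ x → MidSteps x → InCubeCone D (apply cubeMatrix x)
  MidSteps⇒cube x steps i j j≡K i<K =
    subst (0ℚ ≤ℚ_) (sym yᵢ≡) (c≤b+a⇒0≤a+b-c (s x) (ψ x (K +ℕ toℕ i)) (ψ x (K +ℕ suc (toℕ i))) (proj₁ (steps (toℕ i) i<K))) ,
    subst₂ _≤ℚ_ (sym yᵢ≡) (sym yⱼ≡)
           (b≤c+d⇒a+b-c≤a+d (s x) (ψ x (K +ℕ toℕ i)) (ψ x (K +ℕ suc (toℕ i))) (t x) (proj₂ (steps (toℕ i) i<K)))
    where
    y = apply cubeMatrix x
    yᵢ≡ : lookup y i ≡ s x + ψ x (K +ℕ toℕ i) - ψ x (K +ℕ suc (toℕ i))
    yᵢ≡ = trans (lookup≡lookupOr 0ℚ y i) (cube-coord x (toℕ i) i<K)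
    yⱼ≡ : lookup y j ≡ s x + t x
    yⱼ≡ = trans (lookup≡lookupOr 0ℚ y j) (trans (cong (coord y) j≡K) (cube-coord-K x))

  cube⇒MidSteps : ∀ x → InCubeCone D (apply cubeMatrix x) → MidSteps x
  cube⇒MidSteps x cube r r<K =
    0≤a+b-c⇒c≤b+a (s x) (ψ x (K +ℕ r)) (ψ x (K +ℕ suc r)) (subst (0ℚ ≤ℚ_) yᵣ≡ (proj₁ bounds)) ,
    a+b-c≤a+d⇒b≤c+d (s x) (ψ x (K +ℕ r)) (ψ x (K +ℕ suc r)) (t x) (subst₂ _≤ℚ_ yᵣ≡ y_K≡ (proj₂ bounds))
    where
    y = apply cubeMatrix x
    r<D = ℕP.m<n⇒m<1+n r<K
    K<D = ℕP.n<1+n K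
    bounds = cube (fromℕ< r<D) (fromℕ< K<D) (toℕ-fromℕ< K<D) (subst (_< K) (sym (toℕ-fromℕ< r<D)) r<K)
    yᵣ≡ : lookup y (fromℕ< r<D) ≡ s x + ψ x (K +ℕ r) - ψ x (K +ℕ suc r)
    yᵣ≡ = trans (lookup≡lookupOr 0ℚ y (fromℕ< r<D)) (trans (cong (coord y) (toℕ-fromℕ< r<D)) (cube-coord x r r<K))
    y_K≡ : lookup y (fromℕ< K<D) ≡ s x + t x
    y_K≡ = trans (lookup≡lookupOr 0ℚ y (fromℕ< K<D)) (trans (cong (coord y) (toℕ-fromℕ< K<D)) (cube-coord-K x))

proposition6p14 : (d : ℕ) → 3 ≤ d →
    Σ (Matrix d) λ M → Invertible M ×
      (∀ x → InF d x → InCubeCone d (apply M x)) ×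
      (∀ y → InCubeCone d y → ∃ λ x → InF d x × apply M x ≡ y)
proposition6p14 (suc (suc (suc k))) (s≤s (s≤s (s≤s z≤n))) =
  cubeMatrix , (inverseMatrix , inverse∘cube , cube∘inverse) , forward , backward
  where
  open CubeCoordinates k
  open Values k
  forward : ∀ x → InF _ x → InCubeCone _ (apply cubeMatrix x)
  forward x inF = MidSteps⇒cube x (InF⇒MidSteps x inF)
  backward : ∀ y → InCubeCone _ y → ∃ λ x → InF _ x × apply cubeMatrix x ≡ y
  backward y cube = x , MidSteps⇒InF x (cube⇒MidSteps x (subst (InCubeCone _) (sym (cube∘inverse y)) cube)) , cube∘inverse y
    where
    x = apply inverseMatrix y
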